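{- Let $G$ be a nice connected graph with $n$ vertices, maximum degree $\Delta$ and chromatic number $k$, and let $W$ be a closed walk of $G$ of length $p$ going through all vertices. Then ${\rm ML}^{\rm W}(G) \leq p + (n-1)(2k-2)+2\Delta$.
   Context: All graphs are finite and simple; a graph is nice if it is connected and not isomorphic to $K_2$. A walk of $G$ is a sequence of vertices in which consecutive vertices are adjacent (repetitions allowed); its length is its number of traversed edges with repetition; it is closed if it starts and ends at the same vertex. For a walk $W$, $G+W$ is the multigraph on $V(G)$ with edge multiset $E(G)$ plus every edge traversed by $W$, added as many times as traversed. A multigraph is locally irregular if no two adjacent vertices have the same degree; a walk $W$ is irregularising if $G+W$ is locally irregular. ${\rm ML}^{\rm W}(G)$ is the minimum length of an irregularising walk of $G$ (length $0$ allowed), $+\infty$ if none exists. -}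

module Defs where

open import Data.Nat using (ℕ; zero; suc; _+_; _∸_; _≤_; _<_)
open import Data.Bool using (Bool; true; false; if_then_else_)
open import Data.Fin using (Fin; _≟_)
open import Data.List using (List; []; _∷_; length; map; allFin)
open import Data.Nat.ListAction using (sum)
open import Data.List.Membership.Propositional using (_∈_)
open import Data.Product using (Σ; _×_; ∃-syntax)
open import Data.Unit using (⊤)
open import Data.Empty using (⊥)
open import Relation.Nullary using (¬_; does)
open import Relation.Binary.PropositionalEquality using (_≡_; _≢_)
open import Function.Bundles using (Inverse)
open import Relation.Binary.PropositionalEquality using (setoid)

record Graph : Set where
  field
    n     : ℕ
    adj   : Fin n → Fin n → Bool
    sym   : ∀ u v → adj u v ≡ adj v u
    loopless : ∀ v → adj v v ≡ false

open Graph public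

Adj : (G : Graph) → Fin (n G) → Fin (n G) → Set
Adj G u v = adj G u v ≡ true

deg : (G : Graph) → Fin (n G) → ℕ
deg G v = sum (map (λ u → if adj G v u then 1 else 0) (allFin (n G)))

IsWalk : (G : Graph) → List (Fin (n G)) → Set
IsWalk G [] = ⊥
IsWalk G (x ∷ []) = ⊤
IsWalk G (x ∷ y ∷ r) = Adj G x y × IsWalk G (y ∷ r)

-- length of a walk = number of traversed edges
walkLength : ∀ {A : Set} → List A → ℕ
walkLength w = length w ∸ 1

headOr : ∀ {A : Set} → A → List A → A
headOr d [] = d
headOr d (x ∷ _) = x

lastOr : ∀ {A : Set} → A → List A → A
lastOr d [] = d
lastOr d (x ∷ []) = x
lastOr d (x ∷ y ∷ r) = lastOr d (y ∷ r)

WalkFromTo : (G : Graph) → Fin (n G) → Fin (n G) → List (Fin (n G)) → Set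
WalkFromTo G u v w = IsWalk G w × (headOr u w ≡ u) × (lastOr u w ≡ v)

IsClosedWalk : (G : Graph) → List (Fin (n G)) → Set
IsClosedWalk G [] = ⊥
IsClosedWalk G (x ∷ r) = IsWalk G (x ∷ r) × (lastOr x (x ∷ r) ≡ x)

CoversAllVertices : (G : Graph) → List (Fin (n G)) → Set
CoversAllVertices G w = ∀ v → v ∈ w

Connected : Graph → Set
Connected G = ∀ u v → ∃[ w ] WalkFromTo G u v w

K2 : Graph
K2 = record { n = 2 ; adj = a ; sym = s ; loopless = l }
  where
  a : Fin 2 → Fin 2 → Bool
  a Fin.zero Fin.zero = false
  a Fin.zero (Fin.suc Fin.zero) = true
  a (Fin.suc Fin.zero) Fin.zero = true
  a (Fin.suc Fin.zero) (Fin.suc Fin.zero) = false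
  s : ∀ u v → a u v ≡ a v u
  s Fin.zero Fin.zero = _≡_.refl
  s Fin.zero (Fin.suc Fin.zero) = _≡_.refl
  s (Fin.suc Fin.zero) Fin.zero = _≡_.refl
  s (Fin.suc Fin.zero) (Fin.suc Fin.zero) = _≡_.refl
  l : ∀ v → a v v ≡ false
  l Fin.zero = _≡_.refl
  l (Fin.suc Fin.zero) = _≡_.refl

Isomorphic : Graph → Graph → Set
Isomorphic G H =
  Σ (Inverse (setoid (Fin (n G))) (setoid (Fin (n H)))) λ f →
    ∀ u v → adj G u v ≡ adj H (Inverse.to f u) (Inverse.to f v)

Nice : Graph → Set
Nice G = Connected G × ¬ Isomorphic G K2

MaxDegree : (G : Graph) → ℕ → Set
MaxDegree G Δ = (∀ v → deg G v ≤ Δ) × (∃[ v ] deg G v ≡ Δ)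

ProperColouring : (G : Graph) → (k : ℕ) → (Fin (n G) → Fin k) → Set
ProperColouring G k c = ∀ u v → Adj G u v → c u ≢ c v

Colourable : Graph → ℕ → Set
Colourable G k = ∃[ c ] ProperColouring G k c

ChromaticNumber : Graph → ℕ → Set
ChromaticNumber G k = Colourable G k × (∀ m → m < k → ¬ Colourable G m)

-- the multigraph G + W: degree of v is deg_G v plus the number of edge
-- traversals of W incident to v (each traversal of xy adds one to x and one to y)
ind : ∀ {m} → Fin m → Fin m → ℕ
ind x v = if does (x ≟ v) then 1 else 0

extra : ∀ {m} → Fin m → List (Fin m) → ℕ
extra v [] = 0
extra v (x ∷ []) = 0
extra v (x ∷ y ∷ r) = ind x v + ind y v + extra v (y ∷ r)

degPlus : (G : Graph) → List (Fin (n G)) → Fin (n G) → ℕ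
degPlus G w v = deg G v + extra v w

Traverses : ∀ {m} → List (Fin m) → Fin m → Fin m → Set
Traverses [] u v = ⊥
Traverses (x ∷ []) u v = ⊥
Traverses (x ∷ y ∷ r) u v =
  ((x ≡ u × y ≡ v) Data.Sum.⊎ (x ≡ v × y ≡ u)) Data.Sum.⊎ Traverses (y ∷ r) u v
  where import Data.Sum

AdjPlus : (G : Graph) → List (Fin (n G)) → Fin (n G) → Fin (n G) → Set
AdjPlus G w u v = Adj G u v Data.Sum.⊎ Traverses w u v
  where import Data.Sum

LocallyIrregularPlus : (G : Graph) → List (Fin (n G)) → Set
LocallyIrregularPlus G w =
  ∀ u v → AdjPlus G w u v → degPlus G w u ≢ degPlus G w v

Irregularising : (G : Graph) → List (Fin (n G)) → Set
Irregularising G w = IsWalk G w × LocallyIrregularPlus G w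

-- ML^W(G) ≤ b  (ML^W is the minimum length of an irregularising walk,
-- +∞ if none): there is an irregularising walk of length at most b.
MLW≤ : Graph → ℕ → Set
MLW≤ G b = ∃[ w ] (Irregularising G w × walkLength w ≤ b)

-- Fix a proper colouring c with k colours.  If every vertex v of G + F satisfies
-- ⌊d(v)/2⌋ ≡ c(v) (mod k), then G + F is locally irregular: adjacent vertices of equal
-- degree would receive equal colours.  Inserting a detour u v u into a closed walk
-- ("bouncing" on uv) raises ⌊d/2⌋ by one at u and at v.  Processing a spanning tree
-- from the leaves, fewer than k bounces on the edge to its parent put each non-root
-- vertex on target, at a cost of at most (n − 1)(2k − 2).  For the tree's 2-colouring
-- σ = ±1 these bounces preserve κ = Σ σ(v)(⌊d(v)/2⌋ − c(v)), and once all other vertices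
-- are on target the root is on target iff k ∣ κ.  Beforehand κ is made divisible by k
-- with at most 2Δ further steps: bouncing on an edge uv with σ(u) = σ(v) moves κ by
-- 2σ(u), which suffices for odd k ≤ Δ + 1; for even k an open tail of length at most 2,
-- appended at a root chosen so that the tail changes κ by an odd amount, first makes κ
-- even; if no edge has σ(u) = σ(v), then G is bipartite and k = 2.

module Submission where

open import Defs hiding (sym)
open import Data.Nat using (ℕ; _+_; _*_; _∸_)
open import Data.List using (List)
open import Data.Fin using (Fin)
open import Relation.Binary.PropositionalEquality using (_≡_)

import Algebra.Properties.CommutativeMonoid.Sum as CMSum
open import Data.Bool as Bool using (Bool; true; false; not; if_then_else_)
open import Data.Fin as Fin using (zero; suc; _≟_; toℕ; fromℕ<; punchOut)
import Data.Fin.Properties as FinP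
open import Data.Integer as ℤ using (ℤ; +_; 0ℤ; 1ℤ; -1ℤ)
open import Data.Integer.DivMod using (_%ℕ_; _/ℕ_; a≡a%ℕn+[a/ℕn]*n; n%ℕd<d)
open import Data.Integer.Divisibility.Signed
import Data.Integer.Properties as ℤP
open import Data.Integer.Tactic.RingSolver using (solve-∀)
open import Data.List using ([]; _∷_; _++_; [_]; length; map; lookup; replicate; tabulate)
open import Data.List.Membership.DecPropositional using () renaming (_∈?_ to ∈?)
open import Data.List.Membership.Propositional using (_∈_; _∉_)
open import Data.List.Membership.Propositional.Properties using (∈-++⁺ˡ; ∈-++⁺ʳ; ∈-++⁻; ∈-∃++; ∈-lookup)
import Data.List.Properties as ListP
open import Data.List.Relation.Binary.Permutation.Propositional.Properties using (∈-resp-↭; ++-comm)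
open import Data.List.Relation.Unary.All as All using (All; []; _∷_)
import Data.List.Relation.Unary.All.Properties as AllP
open import Data.List.Relation.Unary.All.Properties.Core using (¬Any⇒All¬)
open import Data.List.Relation.Unary.AllPairs using ([]; _∷_)
open import Data.List.Relation.Unary.Any using (here; there)
open import Data.List.Relation.Unary.Unique.Propositional using (Unique)
open import Data.Nat as ℕ using (zero; suc; _≤_; _<_; z≤n; s≤s; NonZero; _/_; _%_)
open import Data.Nat.DivMod using (m≡m%n+[m/n]*n; m%n<n; +-distrib-/-∣ʳ; m*n/n≡m)
open import Data.Nat.Divisibility using (>⇒∤) renaming (divides to dividesℕ; _∣_ to _∣ℕ_)
import Data.Nat.ListAction as ListAction
import Data.Nat.Properties as ℕP
import Data.Nat.Tactic.RingSolver as ℕRing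
open import Data.Product using (∃-syntax; _×_; _,_; proj₁; proj₂; uncurry)
open import Data.Sum using (_⊎_; inj₁; inj₂)
open import Data.Unit using (tt)
open import Data.Vec.Functional using (removeAt; updateAt)
open import Data.Vec.Functional.Properties using (updateAt-updates; updateAt-minimal)
open import Function using (_∘_; id; const; Injective)
open import Function.Construct.Identity using (↔-id)
open import Relation.Binary.PropositionalEquality using (refl; sym; trans; cong; cong₂; subst; subst₂; _≢_; module ≡-Reasoning)
open import Relation.Nullary using (Dec; does; yes; no; contradiction)
open import Relation.Nullary.Decidable using (_→-dec_; _×-dec_; ¬?)

open CMSum ℤP.+-0-commutativeMonoid using (sum; ∑-distrib-+; sum-cong-≗; sum-replicate-zero)
module ℕΣ = CMSum ℕP.+-0-commutativeMonoid

half-+-double : ∀ m x → (m + 2 * x) / 2 ≡ m / 2 + x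
half-+-double m x = begin
  (m + 2 * x) / 2   ≡⟨ cong (λ y → (m + y) / 2) (ℕP.*-comm 2 x) ⟩
  (m + x * 2) / 2   ≡⟨ +-distrib-/-∣ʳ m {d = 2} (dividesℕ x refl) ⟩
  m / 2 + x * 2 / 2 ≡⟨ cong (λ y → m / 2 + y) (m*n/n≡m x 2) ⟩
  m / 2 + x         ∎
  where open ≡-Reasoning

parity-cases : ∀ m → m % 2 ≡ 0 ⊎ m % 2 ≡ 1
parity-cases m with m % 2 | m%n<n m 2
... | 0 | _ = inj₁ refl
... | 1 | _ = inj₂ refl
... | suc (suc _) | s≤s (s≤s ())

half-suc : ∀ m → (m + 1) / 2 ≡ m / 2 + m % 2
half-suc m with m % 2 | parity-cases m | m≡m%n+[m/n]*n m 2
... | _ | inj₁ refl | m≡ = begin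
  (m + 1) / 2               ≡⟨ cong (λ y → (y + 1) / 2) m≡ ⟩
  (m / 2 * 2 + 1) / 2       ≡⟨ cong (_/ 2) (ℕP.+-comm (m / 2 * 2) 1) ⟩
  (1 + m / 2 * 2) / 2       ≡⟨ +-distrib-/-∣ʳ 1 {d = 2} (dividesℕ (m / 2) refl) ⟩
  m / 2 * 2 / 2             ≡⟨ m*n/n≡m (m / 2) 2 ⟩
  m / 2                     ≡⟨ ℕP.+-identityʳ (m / 2) ⟨
  m / 2 + 0                 ∎
  where open ≡-Reasoning
... | _ | inj₂ refl | m≡ = begin
  (m + 1) / 2               ≡⟨ cong (λ y → (y + 1) / 2) m≡ ⟩
  (1 + m / 2 * 2 + 1) / 2   ≡⟨ cong (_/ 2) (ℕP.+-comm (1 + m / 2 * 2) 1) ⟩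
  (suc (m / 2) * 2) / 2     ≡⟨ m*n/n≡m (suc (m / 2)) 2 ⟩
  suc (m / 2)               ≡⟨ ℕP.+-comm 1 (m / 2) ⟩
  m / 2 + 1                 ∎
  where open ≡-Reasoning

sign : Bool → ℤ
sign true  = 1ℤ
sign false = -1ℤ

sign-not : ∀ b → sign (not b) ℤ.+ sign b ≡ 0ℤ
sign-not true  = refl
sign-not false = refl

sign² : ∀ b → sign b ℤ.* sign b ≡ 1ℤ
sign² true  = refl
sign² false = refl

Even Odd : ℤ → Set
Even x = + 2 ∣ x
Odd x = + 2 ∣ x ℤ.+ 1ℤ

even-or-odd : ∀ x → Even x ⊎ Odd x
even-or-odd x with x %ℕ 2 | n%ℕd<d x 2 | a≡a%ℕn+[a/ℕn]*n x 2
... | 0 | _ | x≡ = inj₁ (divides (x /ℕ 2) (trans x≡ (ℤP.+-identityˡ _)))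
... | 1 | _ | x≡ = inj₂ (divides (x /ℕ 2 ℤ.+ 1ℤ) (trans (cong (ℤ._+ 1ℤ) x≡) (shape (x /ℕ 2))))
  where
  shape : ∀ q → 1ℤ ℤ.+ q ℤ.* + 2 ℤ.+ 1ℤ ≡ (q ℤ.+ 1ℤ) ℤ.* + 2
  shape = solve-∀
... | suc (suc _) | s≤s (s≤s ()) | _

odd+odd : ∀ {x y} → Odd x → Odd y → Even (x ℤ.+ y)
odd+odd {x} {y} ox oy =
  subst (+ 2 ∣_) (shape x y) (∣m∣n⇒∣m-n (∣m∣n⇒∣m+n ox oy) ∣-refl)
  where
  shape : ∀ x y → (x ℤ.+ 1ℤ) ℤ.+ (y ℤ.+ 1ℤ) ℤ.- + 2 ≡ x ℤ.+ y
  shape = solve-∀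

even+odd : ∀ {x y} → Even x → Odd y → Odd (x ℤ.+ y)
even+odd {x} {y} ex oy = subst (+ 2 ∣_) (sym (ℤP.+-assoc x y 1ℤ)) (∣m∣n⇒∣m+n ex oy)

odd-sign : ∀ b → Odd (sign b)
odd-sign true  = divides 1ℤ refl
odd-sign false = divides 0ℤ refl

odd-edge-change : ∀ x y a b → a % 2 ≢ b % 2 → Odd (sign x ℤ.* + (a % 2) ℤ.+ sign y ℤ.* + (b % 2))
odd-edge-change x y a b a≢b with parity-cases a | parity-cases b
... | inj₁ a0 | inj₁ b0 = contradiction (trans a0 (sym b0)) a≢b
... | inj₂ a1 | inj₂ b1 = contradiction (trans a1 (sym b1)) a≢b
... | inj₁ a0 | inj₂ b1 rewrite a0 | b1 =
  subst Odd (sym (trans (cong₂ ℤ._+_ (ℤP.*-zeroʳ (sign x)) (ℤP.*-identityʳ (sign y))) (ℤP.+-identityˡ (sign y))))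
            (odd-sign y)
... | inj₂ a1 | inj₁ b0 rewrite a1 | b0 =
  subst Odd (sym (trans (cong₂ ℤ._+_ (ℤP.*-identityʳ (sign x)) (ℤP.*-zeroʳ (sign y))) (ℤP.+-identityʳ (sign x))))
            (odd-sign x)

odd-path-change : ∀ x y z a b → a % 2 ≡ b % 2 →
  Odd (sign x ℤ.* + (a % 2) ℤ.+ sign y ℤ.+ sign z ℤ.* + (b % 2))
odd-path-change x y z a b a≡b with parity-cases a
... | inj₁ a0 rewrite sym a≡b | a0 = subst Odd (sym (drop (sign x) (sign y) (sign z))) (odd-sign y)
  where
  drop : ∀ p q r → p ℤ.* 0ℤ ℤ.+ q ℤ.+ r ℤ.* 0ℤ ≡ q
  drop = solve-∀
... | inj₂ a1 rewrite sym a≡b | a1 =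
  subst Odd (sym (keep (sign x) (sign y) (sign z)))
            (even+odd {sign x ℤ.+ sign y} (odd+odd {sign x} (odd-sign x) (odd-sign y)) (odd-sign z))
  where
  keep : ∀ p q r → p ℤ.* 1ℤ ℤ.+ q ℤ.+ r ℤ.* 1ℤ ≡ p ℤ.+ q ℤ.+ r
  keep = solve-∀

shift-to-multiple : ∀ m .{{_ : NonZero m}} x → ∃[ j ] j < m × + m ∣ x ℤ.+ + j
shift-to-multiple m x = j , n%ℕd<d (ℤ.- x) m , divides (ℤ.- q) x+j≡
  where
  j : ℕ
  j = (ℤ.- x) %ℕ m
  q : ℤ
  q = (ℤ.- x) /ℕ m
  open ≡-Reasoning
  x+j≡ : x ℤ.+ + j ≡ ℤ.- q ℤ.* + m
  x+j≡ = begin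
    x ℤ.+ + j                        ≡⟨ cong (ℤ._+ + j) (ℤP.neg-involutive x) ⟨
    ℤ.- (ℤ.- x) ℤ.+ + j              ≡⟨ cong (λ y → ℤ.- y ℤ.+ + j) (a≡a%ℕn+[a/ℕn]*n (ℤ.- x) m) ⟩
    ℤ.- (+ j ℤ.+ q ℤ.* + m) ℤ.+ + j  ≡⟨ cancel (+ j) q (+ m) ⟩
    ℤ.- q ℤ.* + m                    ∎
    where
    cancel : ∀ a b c → ℤ.- (a ℤ.+ b ℤ.* c) ℤ.+ a ≡ ℤ.- b ℤ.* c
    cancel = solve-∀

-- 2h ≡ 1 (mod k), so j ≡ −σκh makes κ + 2σj ≡ 0 (mod k).
odd-modulus-correction : ∀ k .{{_ : NonZero k}} h → suc k ≡ h + h → ∀ κ σ → σ ℤ.* σ ≡ 1ℤ →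
  ∃[ j ] j < k × + k ∣ κ ℤ.+ + j ℤ.* (σ ℤ.+ σ)
odd-modulus-correction k h 1+k≡2h κ σ σ²≡1 with shift-to-multiple k (σ ℤ.* κ ℤ.* + h)
... | j , j<k , k∣ =
  j , j<k , subst (+ k ∣_) regroup (∣m∣n⇒∣m-n (∣n⇒∣m*n (σ ℤ.+ σ) k∣) (∣n⇒∣m*n κ ∣-refl))
  where
  open ≡-Reasoning
  2h≡1+k : + h ℤ.+ + h ≡ 1ℤ ℤ.+ + k
  2h≡1+k = trans (sym (ℤP.pos-+ h h)) (trans (cong +_ (sym 1+k≡2h)) (ℤP.pos-+ 1 k))
  regroup : (σ ℤ.+ σ) ℤ.* (σ ℤ.* κ ℤ.* + h ℤ.+ + j) ℤ.- κ ℤ.* + k ≡ κ ℤ.+ + j ℤ.* (σ ℤ.+ σ)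
  regroup = begin
    (σ ℤ.+ σ) ℤ.* (σ ℤ.* κ ℤ.* + h ℤ.+ + j) ℤ.- κ ℤ.* + k
      ≡⟨ expand σ κ (+ h) (+ j) (+ k) ⟩
    κ ℤ.* (σ ℤ.* σ) ℤ.* (+ h ℤ.+ + h) ℤ.- κ ℤ.* + k ℤ.+ + j ℤ.* (σ ℤ.+ σ)
      ≡⟨ cong₂ (λ a b → κ ℤ.* a ℤ.* b ℤ.- κ ℤ.* + k ℤ.+ + j ℤ.* (σ ℤ.+ σ)) σ²≡1 2h≡1+k ⟩
    κ ℤ.* 1ℤ ℤ.* (1ℤ ℤ.+ + k) ℤ.- κ ℤ.* + k ℤ.+ + j ℤ.* (σ ℤ.+ σ)
      ≡⟨ collapse κ (+ j) (+ k) σ ⟩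
    κ ℤ.+ + j ℤ.* (σ ℤ.+ σ) ∎
    where
    expand : ∀ σ κ h j k → (σ ℤ.+ σ) ℤ.* (σ ℤ.* κ ℤ.* h ℤ.+ j) ℤ.- κ ℤ.* k
                           ≡ κ ℤ.* (σ ℤ.* σ) ℤ.* (h ℤ.+ h) ℤ.- κ ℤ.* k ℤ.+ j ℤ.* (σ ℤ.+ σ)
    expand = solve-∀
    collapse : ∀ κ j k σ → κ ℤ.* 1ℤ ℤ.* (1ℤ ℤ.+ k) ℤ.- κ ℤ.* k ℤ.+ j ℤ.* (σ ℤ.+ σ)
                          ≡ κ ℤ.+ j ℤ.* (σ ℤ.+ σ)
    collapse = solve-∀

even-modulus-correction : ∀ h .{{_ : NonZero h}} κ σ → Even κ → σ ℤ.* σ ≡ 1ℤ →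
  ∃[ j ] j < h × + (h + h) ∣ κ ℤ.+ + j ℤ.* (σ ℤ.+ σ)
even-modulus-correction h κ σ (divides μ κ≡) σ²≡1 with shift-to-multiple h (σ ℤ.* μ)
... | j , j<h , divides q σμ+j≡ = j , j<h , divides (σ ℤ.* q) κ+2σj≡
  where
  open ≡-Reasoning
  κ+2σj≡ : κ ℤ.+ + j ℤ.* (σ ℤ.+ σ) ≡ σ ℤ.* q ℤ.* + (h + h)
  κ+2σj≡ = begin
    κ ℤ.+ + j ℤ.* (σ ℤ.+ σ)
      ≡⟨ cong (λ y → y ℤ.+ + j ℤ.* (σ ℤ.+ σ)) κ≡ ⟩
    μ ℤ.* + 2 ℤ.+ + j ℤ.* (σ ℤ.+ σ)
      ≡⟨ cong (λ y → y ℤ.* + 2 ℤ.+ + j ℤ.* (σ ℤ.+ σ)) (ℤP.*-identityʳ μ) ⟨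
    μ ℤ.* 1ℤ ℤ.* + 2 ℤ.+ + j ℤ.* (σ ℤ.+ σ)
      ≡⟨ cong (λ s → μ ℤ.* s ℤ.* + 2 ℤ.+ + j ℤ.* (σ ℤ.+ σ)) σ²≡1 ⟨
    μ ℤ.* (σ ℤ.* σ) ℤ.* + 2 ℤ.+ + j ℤ.* (σ ℤ.+ σ)
      ≡⟨ factor μ σ (+ j) ⟩
    σ ℤ.* (σ ℤ.* μ ℤ.+ + j) ℤ.* + 2
      ≡⟨ cong (λ y → σ ℤ.* y ℤ.* + 2) σμ+j≡ ⟩
    σ ℤ.* (q ℤ.* + h) ℤ.* + 2
      ≡⟨ double σ q (+ h) ⟩
    σ ℤ.* q ℤ.* (+ h ℤ.+ + h)
      ≡⟨ cong (σ ℤ.* q ℤ.*_) (ℤP.pos-+ h h) ⟨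
    σ ℤ.* q ℤ.* + (h + h) ∎
    where
    factor : ∀ μ σ j → μ ℤ.* (σ ℤ.* σ) ℤ.* + 2 ℤ.+ j ℤ.* (σ ℤ.+ σ)
                      ≡ σ ℤ.* (σ ℤ.* μ ℤ.+ j) ℤ.* + 2
    factor = solve-∀
    double : ∀ σ q h → σ ℤ.* (q ℤ.* h) ℤ.* + 2 ≡ σ ℤ.* q ℤ.* (h ℤ.+ h)
    double = solve-∀

residue-unique : ∀ {k a b} → a < k → b < k → + k ∣ + a ℤ.- + b → a ≡ b
residue-unique {k} {a} {b} a<k b<k k∣a-b with ℤ.∣ + a ℤ.- + b ∣ in dist≡
... | zero = ℤP.+-injective (ℤP.i-j≡0⇒i≡j (+ a) (+ b) (ℤP.∣i∣≡0⇒i≡0 dist≡))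
... | suc d = contradiction (subst (k ∣ℕ_) dist≡ (∣⇒∣ᵤ k∣a-b)) (>⇒∤ (subst (_< k) dist≡ distance<k))
  where
  distance<k : ℤ.∣ + a ℤ.- + b ∣ < k
  distance<k rewrite ℤP.[+m]-[+n]≡m⊖n a b with ℕP.≤-total a b
  ... | inj₁ a≤b = ℕP.≤-<-trans (ℕP.≤-reflexive (ℤP.∣⊖∣-≤ a≤b)) (ℕP.≤-<-trans (ℕP.m∸n≤m b a) b<k)
  ... | inj₂ b≤a = ℕP.≤-<-trans (ℕP.≤-reflexive (trans (ℤP.∣m⊖n∣≡∣n⊖m∣ a b) (ℤP.∣⊖∣-≤ b≤a)))
                                (ℕP.≤-<-trans (ℕP.m∸n≤m a b) a<k)

double-product : ∀ k m → 2 * ((k ∸ 1) * m) ≡ m * (2 * k ∸ 2)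
double-product k m = begin
  2 * ((k ∸ 1) * m)   ≡⟨ ℕP.*-assoc 2 (k ∸ 1) m ⟨
  2 * (k ∸ 1) * m     ≡⟨ cong (_* m) (ℕP.*-distribˡ-∸ 2 k 1) ⟩
  (2 * k ∸ 2) * m     ≡⟨ ℕP.*-comm (2 * k ∸ 2) m ⟩
  m * (2 * k ∸ 2)     ∎
  where open ≡-Reasoning

halving : ∀ k → (∃[ h ] k ≡ h + h) ⊎ (∃[ h ] suc k ≡ h + h)
halving zero    = inj₁ (0 , refl)
halving (suc k) with halving k
... | inj₁ (h , k≡2h)   = inj₂ (suc h , cong suc (trans (cong suc k≡2h) (sym (ℕP.+-suc h h))))
... | inj₂ (h , 1+k≡2h) = inj₁ (h , 1+k≡2h)

∑-ind : ∀ {m} (f : Fin m → ℤ) a → sum (λ v → f v ℤ.* + ind a v) ≡ f a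
∑-ind {suc m} f zero = begin
  f zero ℤ.* 1ℤ ℤ.+ sum {m} (λ v → f (suc v) ℤ.* 0ℤ)
    ≡⟨ cong₂ ℤ._+_ (ℤP.*-identityʳ (f zero)) (sum-cong-≗ {m} (ℤP.*-zeroʳ ∘ f ∘ suc)) ⟩
  f zero ℤ.+ sum {m} (λ _ → 0ℤ)  ≡⟨ cong (λ y → f zero ℤ.+ y) (sum-replicate-zero m) ⟩
  f zero ℤ.+ 0ℤ                  ≡⟨ ℤP.+-identityʳ _ ⟩
  f zero                          ∎
  where open ≡-Reasoning
∑-ind {suc m} f (suc a) =
  trans (cong₂ ℤ._+_ (ℤP.*-zeroʳ (f zero)) (∑-ind (f ∘ suc) a)) (ℤP.+-identityˡ _)

∣-∑ : ∀ {d m} (f : Fin m → ℤ) → (∀ v → d ∣ f v) → d ∣ sum f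
∣-∑ {m = zero}  f all = divides 0ℤ refl
∣-∑ {m = suc m} f all = ∣m∣n⇒∣m+n (all zero) (∣-∑ (f ∘ suc) (all ∘ suc))

∣-∑⁻ : ∀ {d m} (f : Fin m → ℤ) r → d ∣ sum f → (∀ v → v ≢ r → d ∣ f v) → d ∣ f r
∣-∑⁻ f zero d∣∑ others = ∣m+n∣n⇒∣m d∣∑ (∣-∑ (f ∘ suc) (λ v → others (suc v) λ ()))
∣-∑⁻ f (suc r) d∣∑ others =
  ∣-∑⁻ (f ∘ suc) r (∣m+n∣m⇒∣n d∣∑ (others zero λ ()))
                   (λ v v≢r → others (suc v) (v≢r ∘ FinP.suc-injective))

injection-count : ∀ {a m} (P : Fin m → ℕ) (f : Fin a → Fin m) → Injective _≡_ _≡_ f →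
  (∀ i → 1 ≤ P (f i)) → a ≤ ℕΣ.sum P
injection-count {zero}          P f _   _   = z≤n
injection-count {suc a} {zero}  P f _   _   with f zero
... | ()
injection-count {suc a} {suc m} P f inj pos = begin
  suc a
    ≤⟨ ℕP.+-mono-≤ (pos zero) (injection-count (removeAt P (f zero)) f′ f′-inj f′-pos) ⟩
  P (f zero) + ℕΣ.sum (removeAt P (f zero)) ≡⟨ ℕΣ.sum-remove P ⟨
  ℕΣ.sum P                                 ∎
  where
  open ℕP.≤-Reasoning
  f₀≢ : ∀ i → f zero ≢ f (suc i)
  f₀≢ i = (λ ()) ∘ inj
  f′ : Fin a → Fin m
  f′ i = punchOut (f₀≢ i)
  f′-inj : Injective _≡_ _≡_ f′
  f′-inj {i} {j} eq = FinP.suc-injective (inj (FinP.punchOut-injective (f₀≢ i) (f₀≢ j) eq))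
  f′-pos : ∀ i → 1 ≤ removeAt P (f zero) (f′ i)
  f′-pos i = subst (λ v → 1 ≤ P v) (sym (FinP.punchIn-punchOut (f₀≢ i))) (pos (suc i))

sum-tabulate : ∀ {m} (h : Fin m → ℕ) → ListAction.sum (tabulate h) ≡ ℕΣ.sum h
sum-tabulate {zero}  h = refl
sum-tabulate {suc m} h = cong (λ x → h zero + x) (sum-tabulate (h ∘ suc))

extra-++ : ∀ {m} v (xs : List (Fin m)) y ys → extra v (xs ++ y ∷ ys) ≡ extra v (xs ++ [ y ]) + extra v (y ∷ ys)
extra-++ v []                y ys = refl
extra-++ v (x ∷ [])          y ys = cong (_+ extra v (y ∷ ys)) (sym (ℕP.+-identityʳ (ind x v + ind y v)))
extra-++ v (x₁ ∷ x₂ ∷ xs)   y ys =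
  trans (cong (λ e → ind x₁ v + ind x₂ v + e) (extra-++ v (x₂ ∷ xs) y ys))
        (sym (ℕP.+-assoc (ind x₁ v + ind x₂ v) _ _))

lastOr-∷ʳ : ∀ {A : Set} {d : A} a ws → lastOr d (a ∷ ws) ≡ d → ∃[ init ] a ∷ ws ≡ init ++ [ d ]
lastOr-∷ʳ a []       refl = [] , refl
lastOr-∷ʳ a (b ∷ ws) last≡d with lastOr-∷ʳ b ws last≡d
... | init , b∷ws≡ = a ∷ init , cong (a ∷_) b∷ws≡

lookup-injective : ∀ {A : Set} {xs : List A} → Unique xs → ∀ i j → lookup xs i ≡ lookup xs j → i ≡ j
lookup-injective (x≢ ∷ _) zero    zero    _ = refl
lookup-injective (x≢ ∷ _) zero    (suc j) x≡ = contradiction x≡ (All.lookup x≢ (∈-lookup j))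
lookup-injective (x≢ ∷ _) (suc i) zero    ≡x = contradiction (sym ≡x) (All.lookup x≢ (∈-lookup i))
lookup-injective (_ ∷ u)  (suc i) (suc j) eq = cong suc (lookup-injective u i j eq)

Unique-length≤ : ∀ {m} {xs : List (Fin m)} → Unique xs → length xs ≤ m
Unique-length≤ u = FinP.injective⇒≤ (lookup-injective u _ _)

third-vertex : ∀ {m} → 3 ≤ m → (x y : Fin m) → ∃[ z ] z ≢ x × z ≢ y
third-vertex {m} 3≤m x y with FinP.any? (λ z → ¬? (z ≟ x) ×-dec ¬? (z ≟ y))
... | yes found = found
... | no  none  = contradiction (FinP.injective⇒≤ {f = is-x} is-x-injective) (ℕP.<⇒≱ 3≤m)
  where
  is-x : Fin m → Fin 2
  is-x z = if does (z ≟ x) then zero else suc zero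
  is-y : ∀ {z} → z ≢ x → z ≡ y
  is-y {z} z≢x with z ≟ y
  ... | yes z≡y = z≡y
  ... | no  z≢y = contradiction (z , z≢x , z≢y) none
  is-x-injective : ∀ {z z′} → is-x z ≡ is-x z′ → z ≡ z′
  is-x-injective {z} {z′} with z ≟ x | z′ ≟ x
  ... | yes z≡x | yes z′≡x = λ _ → trans z≡x (sym z′≡x)
  ... | no  z≢x | no  z′≢x = λ _ → trans (is-y z≢x) (sym (is-y z′≢x))
  ... | yes _   | no  _    = λ ()
  ... | no  _   | yes _    = λ ()

ind-≢ : ∀ {m} {x v : Fin m} → x ≢ v → ind x v ≡ 0
ind-≢ {x = x} {v} x≢v with x ≟ v
... | yes x≡v = contradiction x≡v x≢v
... | no  _   = refl

ind-refl : ∀ {m} (x : Fin m) → ind x x ≡ 1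
ind-refl x with x ≟ x
... | yes _   = refl
... | no  x≢x = contradiction refl x≢x

ends : ∀ {m} → List (Fin m × Fin m) → Fin m → ℕ
ends []            v = 0
ends ((a , b) ∷ L) v = ind a v + ind b v + ends L v

bounce : ∀ {m} → (Fin m → ℕ) → List (Fin m × Fin m) → Fin m → ℕ
bounce D L v = D v + 2 * ends L v

ends-++ : ∀ {m} (L M : List (Fin m × Fin m)) v → ends (L ++ M) v ≡ ends L v + ends M v
ends-++ []            M v = refl
ends-++ ((a , b) ∷ L) M v =
  trans (cong (λ e → ind a v + ind b v + e) (ends-++ L M v)) (sym (ℕP.+-assoc (ind a v + ind b v) _ _))

ends-replicate : ∀ {m} j (a b v : Fin m) → ends (replicate j (a , b)) v ≡ j * (ind a v + ind b v)
ends-replicate zero    a b v = refl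
ends-replicate (suc j) a b v = cong (λ e → ind a v + ind b v + e) (ends-replicate j a b v)

ends-avoiding : ∀ {m} {L : List (Fin m × Fin m)} x →
  All (λ e → proj₁ e ≢ x × proj₂ e ≢ x) L → ends L x ≡ 0
ends-avoiding x []                       = refl
ends-avoiding x ((a≢x , b≢x) ∷ avoid) rewrite ind-≢ a≢x | ind-≢ b≢x = ends-avoiding x avoid

bounce-++ : ∀ {m} D (L M : List (Fin m × Fin m)) v → bounce D (L ++ M) v ≡ bounce (bounce D L) M v
bounce-++ D L M v = begin
  D v + 2 * ends (L ++ M) v               ≡⟨ cong (λ e → D v + 2 * e) (ends-++ L M v) ⟩
  D v + 2 * (ends L v + ends M v)         ≡⟨ cong (λ e → D v + e) (ℕP.*-distribˡ-+ 2 (ends L v) (ends M v)) ⟩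
  D v + (2 * ends L v + 2 * ends M v)     ≡⟨ ℕP.+-assoc (D v) _ _ ⟨
  D v + 2 * ends L v + 2 * ends M v       ∎
  where open ≡-Reasoning

excess : ∀ {m} → (Fin m → ℕ) → (Fin m → ℕ) → Fin m → ℤ
excess col D v = + (D v / 2) ℤ.- + col v

excess-bounce : ∀ {m} col D L (v : Fin m) → excess col (bounce D L) v ≡ excess col D v ℤ.+ + ends L v
excess-bounce col D L v = begin
  + (bounce D L v / 2) ℤ.- + col v        ≡⟨ cong (λ h → + h ℤ.- + col v) (half-+-double (D v) (ends L v)) ⟩
  + (D v / 2 + ends L v) ℤ.- + col v      ≡⟨ cong (ℤ._- + col v) (ℤP.pos-+ (D v / 2) (ends L v)) ⟩
  + (D v / 2) ℤ.+ + ends L v ℤ.- + col v  ≡⟨ swap (+ (D v / 2)) (+ ends L v) (+ col v) ⟩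
  + (D v / 2) ℤ.- + col v ℤ.+ + ends L v  ∎
  where
  open ≡-Reasoning
  swap : ∀ h e c → h ℤ.+ e ℤ.- c ≡ h ℤ.- c ℤ.+ e
  swap = solve-∀

module Signed {m} (s : Fin m → Bool) where

  σ : Fin m → ℤ
  σ v = sign (s v)

  signed : (Fin m → ℕ) → ℤ
  signed f = sum (λ v → σ v ℤ.* + f v)

  Φ : (Fin m → ℕ) → ℤ
  Φ D = signed (λ v → D v / 2)

  signed-cong : ∀ {f g} → (∀ v → f v ≡ g v) → signed f ≡ signed g
  signed-cong f≗g = sum-cong-≗ {m} (λ v → cong (λ x → σ v ℤ.* + x) (f≗g v))

  signed-+ : ∀ f g → signed (λ v → f v + g v) ≡ signed f ℤ.+ signed g
  signed-+ f g = trans (sum-cong-≗ {m} split) (∑-distrib-+ (λ v → σ v ℤ.* + f v) (λ v → σ v ℤ.* + g v))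
    where
    split : ∀ v → σ v ℤ.* + (f v + g v) ≡ σ v ℤ.* + f v ℤ.+ σ v ℤ.* + g v
    split v = trans (cong (σ v ℤ.*_) (ℤP.pos-+ (f v) (g v))) (ℤP.*-distribˡ-+ (σ v) (+ f v) (+ g v))

  signed-zero : signed (λ _ → 0) ≡ 0ℤ
  signed-zero = trans (sum-cong-≗ {m} (ℤP.*-zeroʳ ∘ σ)) (sum-replicate-zero m)

  signed-ind : ∀ a x → signed (λ v → ind a v * x) ≡ σ a ℤ.* + x
  signed-ind a x = trans (sum-cong-≗ {m} commute) (∑-ind (λ v → σ v ℤ.* + x) a)
    where
    commute : ∀ v → σ v ℤ.* + (ind a v * x) ≡ σ v ℤ.* + x ℤ.* + ind a v
    commute v = begin
      σ v ℤ.* + (ind a v * x)      ≡⟨ cong (λ y → σ v ℤ.* + y) (ℕP.*-comm (ind a v) x) ⟩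
      σ v ℤ.* + (x * ind a v)      ≡⟨ cong (σ v ℤ.*_) (ℤP.pos-* x (ind a v)) ⟩
      σ v ℤ.* (+ x ℤ.* + ind a v)  ≡⟨ ℤP.*-assoc (σ v) (+ x) (+ ind a v) ⟨
      σ v ℤ.* + x ℤ.* + ind a v    ∎
      where open ≡-Reasoning

  signed-ind₁ : ∀ a → signed (ind a) ≡ σ a
  signed-ind₁ a =
    trans (signed-cong (λ v → sym (ℕP.*-identityʳ (ind a v)))) (trans (signed-ind a 1) (ℤP.*-identityʳ (σ a)))

  signed-ends-∷ : ∀ a b L → signed (ends ((a , b) ∷ L)) ≡ σ a ℤ.+ σ b ℤ.+ signed (ends L)
  signed-ends-∷ a b L = begin
    signed (λ v → ind a v + ind b v + ends L v)
      ≡⟨ trans (signed-+ _ (ends L)) (cong (ℤ._+ signed (ends L)) (signed-+ (ind a) (ind b))) ⟩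
    signed (ind a) ℤ.+ signed (ind b) ℤ.+ signed (ends L)
      ≡⟨ cong₂ (λ x y → x ℤ.+ y ℤ.+ signed (ends L)) (signed-ind₁ a) (signed-ind₁ b) ⟩
    σ a ℤ.+ σ b ℤ.+ signed (ends L) ∎
    where open ≡-Reasoning

  signed-ends-balanced : ∀ {L} → All (λ e → s (proj₁ e) ≡ not (s (proj₂ e))) L → signed (ends L) ≡ 0ℤ
  signed-ends-balanced {[]}          []                = signed-zero
  signed-ends-balanced {(a , b) ∷ L} (a≠b ∷ opposite) = begin
    signed (ends ((a , b) ∷ L))        ≡⟨ signed-ends-∷ a b L ⟩
    σ a ℤ.+ σ b ℤ.+ signed (ends L)    ≡⟨ cong₂ ℤ._+_ (trans (cong (λ x → sign x ℤ.+ σ b) a≠b) (sign-not (s b)))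
                                                     (signed-ends-balanced opposite) ⟩
    0ℤ                                 ∎
    where open ≡-Reasoning

  signed-ends-replicate : ∀ j u v → s u ≡ s v → signed (ends (replicate j (u , v))) ≡ + j ℤ.* (σ u ℤ.+ σ u)
  signed-ends-replicate zero    u v _    = signed-zero
  signed-ends-replicate (suc j) u v same = begin
    signed (ends ((u , v) ∷ replicate j (u , v)))  ≡⟨ signed-ends-∷ u v (replicate j (u , v)) ⟩
    σ u ℤ.+ σ v ℤ.+ signed (ends (replicate j (u , v)))
      ≡⟨ cong₂ (λ x y → σ u ℤ.+ sign x ℤ.+ y) (sym same) (signed-ends-replicate j u v same) ⟩
    σ u ℤ.+ σ u ℤ.+ + j ℤ.* (σ u ℤ.+ σ u)           ≡⟨ factor (σ u ℤ.+ σ u) (+ j) ⟩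
    (1ℤ ℤ.+ + j) ℤ.* (σ u ℤ.+ σ u)                  ≡⟨ cong (ℤ._* (σ u ℤ.+ σ u)) (ℤP.pos-+ 1 j) ⟨
    + suc j ℤ.* (σ u ℤ.+ σ u)                       ∎
    where
    open ≡-Reasoning
    factor : ∀ x j → x ℤ.+ j ℤ.* x ≡ (1ℤ ℤ.+ j) ℤ.* x
    factor = solve-∀

  Φ-cong : ∀ {D D′} → (∀ v → D v ≡ D′ v) → Φ D ≡ Φ D′
  Φ-cong D≗D′ = signed-cong (λ v → cong (_/ 2) (D≗D′ v))

  Φ-shift : ∀ D D′ δ → (∀ v → D′ v / 2 ≡ D v / 2 + δ v) → Φ D′ ≡ Φ D ℤ.+ signed δ
  Φ-shift D D′ δ shift = trans (signed-cong shift) (signed-+ (λ v → D v / 2) δ)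

  Φ-bounce : ∀ D L → Φ (bounce D L) ≡ Φ D ℤ.+ signed (ends L)
  Φ-bounce D L = Φ-shift D (bounce D L) (ends L) (λ v → half-+-double (D v) (ends L v))

  Φ-step : ∀ D a → Φ (λ v → D v + ind a v) ≡ Φ D ℤ.+ σ a ℤ.* + (D a % 2)
  Φ-step D a = trans (Φ-shift D (λ v → D v + ind a v) (λ v → ind a v * (D a % 2)) half-step)
                     (cong (λ x → Φ D ℤ.+ x) (signed-ind a (D a % 2)))
    where
    half-step : ∀ v → (D v + ind a v) / 2 ≡ D v / 2 + ind a v * (D a % 2)
    half-step v with a ≟ v
    ... | yes refl = trans (half-suc (D a)) (cong (λ x → D a / 2 + x) (sym (ℕP.*-identityˡ (D a % 2))))
    ... | no  _    = trans (cong (_/ 2) (ℕP.+-identityʳ (D v))) (sym (ℕP.+-identityʳ (D v / 2)))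

  Φ-edge-tail : ∀ D r e → r ≢ e →
    Φ (λ v → D v + extra v (r ∷ e ∷ [])) ≡ Φ D ℤ.+ (σ r ℤ.* + (D r % 2) ℤ.+ σ e ℤ.* + (D e % 2))
  Φ-edge-tail D r e r≢e = begin
    Φ (λ v → D v + extra v (r ∷ e ∷ []))              ≡⟨ Φ-cong (λ v → regroup (D v) (ind r v) (ind e v)) ⟩
    Φ (λ v → D v + ind r v + ind e v)                 ≡⟨ Φ-step (λ v → D v + ind r v) e ⟩
    Φ (λ v → D v + ind r v) ℤ.+ σ e ℤ.* + ((D e + ind r e) % 2)
      ≡⟨ cong₂ (λ x y → x ℤ.+ σ e ℤ.* + (y % 2)) (Φ-step D r)
               (trans (cong (λ x → D e + x) (ind-≢ r≢e)) (ℕP.+-identityʳ (D e))) ⟩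
    Φ D ℤ.+ σ r ℤ.* + (D r % 2) ℤ.+ σ e ℤ.* + (D e % 2) ≡⟨ ℤP.+-assoc (Φ D) _ _ ⟩
    Φ D ℤ.+ (σ r ℤ.* + (D r % 2) ℤ.+ σ e ℤ.* + (D e % 2)) ∎
    where
    open ≡-Reasoning
    regroup : ∀ d a b → d + (a + b + 0) ≡ d + a + b
    regroup = ℕRing.solve-∀

  Φ-path-tail : ∀ D r y e → r ≢ y → y ≢ e → r ≢ e →
    Φ (λ v → D v + extra v (r ∷ y ∷ e ∷ []))
      ≡ Φ D ℤ.+ (σ r ℤ.* + (D r % 2) ℤ.+ σ y ℤ.+ σ e ℤ.* + (D e % 2))
  Φ-path-tail D r y e r≢y y≢e r≢e = begin
    Φ (λ v → D v + extra v (r ∷ y ∷ e ∷ []))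
      ≡⟨ Φ-cong (λ v → regroup (D v) (ind r v) (ind y v) (ind e v)) ⟩
    Φ (λ v → D₂ v + ind e v)
      ≡⟨ Φ-step D₂ e ⟩
    Φ D₂ ℤ.+ σ e ℤ.* + (D₂ e % 2)
      ≡⟨ cong₂ (λ x z → x ℤ.+ σ e ℤ.* + (z % 2)) Φ-D₂ D₂e≡De ⟩
    Φ D₁ ℤ.+ σ y ℤ.+ σ e ℤ.* + (D e % 2)
      ≡⟨ cong (λ x → x ℤ.+ σ y ℤ.+ σ e ℤ.* + (D e % 2)) (Φ-step D r) ⟩
    Φ D ℤ.+ σ r ℤ.* + (D r % 2) ℤ.+ σ y ℤ.+ σ e ℤ.* + (D e % 2)
      ≡⟨ reassoc (Φ D) (σ r ℤ.* + (D r % 2)) (σ y) (σ e ℤ.* + (D e % 2)) ⟩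
    Φ D ℤ.+ (σ r ℤ.* + (D r % 2) ℤ.+ σ y ℤ.+ σ e ℤ.* + (D e % 2)) ∎
    where
    open ≡-Reasoning
    D₁ D₂ : Fin m → ℕ
    D₁ v = D v + ind r v
    D₂ v = D₁ v + 2 * ind y v
    regroup : ∀ d a b c → d + (a + b + (b + c + 0)) ≡ d + a + 2 * b + c
    regroup = ℕRing.solve-∀
    reassoc : ∀ a b c d → a ℤ.+ b ℤ.+ c ℤ.+ d ≡ a ℤ.+ (b ℤ.+ c ℤ.+ d)
    reassoc = solve-∀
    Φ-D₂ : Φ D₂ ≡ Φ D₁ ℤ.+ σ y
    Φ-D₂ = trans (Φ-shift D₁ D₂ (ind y) (λ v → half-+-double (D₁ v) (ind y v)))
                 (cong (λ x → Φ D₁ ℤ.+ x) (signed-ind₁ y))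
    D₂e≡De : D₂ e ≡ D e
    D₂e≡De rewrite ind-≢ r≢e | ind-≢ y≢e = trans (ℕP.+-identityʳ (D e + 0)) (ℕP.+-identityʳ (D e))

  module _ (col : Fin m → ℕ) where

    κ : (Fin m → ℕ) → ℤ
    κ D = Φ D ℤ.- signed col

    κ-as-sum : ∀ D → κ D ≡ sum (λ v → σ v ℤ.* excess col D v)
    κ-as-sum D = begin
      Φ D ℤ.- signed col
        ≡⟨ cong (λ x → Φ D ℤ.+ x) (neg-sum (λ v → σ v ℤ.* + col v)) ⟩
      Φ D ℤ.+ sum (λ v → ℤ.- (σ v ℤ.* + col v))
        ≡⟨ ∑-distrib-+ (λ v → σ v ℤ.* + (D v / 2)) _ ⟨
      sum (λ v → σ v ℤ.* + (D v / 2) ℤ.+ ℤ.- (σ v ℤ.* + col v))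
        ≡⟨ sum-cong-≗ {m} (λ v → distrib (σ v) (+ (D v / 2)) (+ col v)) ⟩
      sum (λ v → σ v ℤ.* excess col D v) ∎
      where
      open ≡-Reasoning
      neg-sum : ∀ {m} (f : Fin m → ℤ) → ℤ.- sum f ≡ sum (λ v → ℤ.- f v)
      neg-sum {zero}  f = refl
      neg-sum {suc m} f = trans (ℤP.neg-distrib-+ (f zero) _) (cong (λ x → ℤ.- f zero ℤ.+ x) (neg-sum (f ∘ suc)))
      distrib : ∀ σ h c → σ ℤ.* h ℤ.+ ℤ.- (σ ℤ.* c) ≡ σ ℤ.* (h ℤ.- c)
      distrib = solve-∀

    root-on-target : ∀ {k} D r → + k ∣ κ D → (∀ v → v ≢ r → + k ∣ excess col D v) →
      + k ∣ excess col D r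
    root-on-target D r k∣κ others = subst (_ ∣_) unsign (∣n⇒∣m*n (σ r) k∣σe)
      where
      k∣σe : _ ∣ σ r ℤ.* excess col D r
      k∣σe = ∣-∑⁻ (λ v → σ v ℤ.* excess col D v) r (subst (_ ∣_) (κ-as-sum D) k∣κ)
                  (λ v v≢r → ∣n⇒∣m*n (σ v) (others v v≢r))
      unsign : σ r ℤ.* (σ r ℤ.* excess col D r) ≡ excess col D r
      unsign = trans (sym (ℤP.*-assoc (σ r) (σ r) _))
                     (trans (cong (ℤ._* excess col D r) (sign² (s r))) (ℤP.*-identityˡ _))

    κ-bounce : ∀ D L → κ (bounce D L) ≡ κ D ℤ.+ signed (ends L)
    κ-bounce D L = trans (cong (ℤ._- signed col) (Φ-bounce D L)) (swap (Φ D) (signed (ends L)) (signed col))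
      where
      swap : ∀ a b c → a ℤ.+ b ℤ.- c ≡ a ℤ.- c ℤ.+ b
      swap = solve-∀

    κ-bounce-[] : ∀ D → κ (bounce D []) ≡ κ D
    κ-bounce-[] D = trans (κ-bounce D []) (trans (cong (λ x → κ D ℤ.+ x) signed-zero) (ℤP.+-identityʳ (κ D)))

    parity-fix : ∀ D₀ D₁ → Odd (Φ D₁ ℤ.- Φ D₀) → Even (κ D₀) ⊎ Even (κ D₁)
    parity-fix D₀ D₁ odd-shift with even-or-odd (κ D₀)
    ... | inj₁ even = inj₁ even
    ... | inj₂ odd  = inj₂ (subst Even (shift (Φ D₀) (Φ D₁) (signed col)) (odd+odd {κ D₀} odd odd-shift))
      where
      shift : ∀ a b c → a ℤ.- c ℤ.+ (b ℤ.- a) ≡ b ℤ.- c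
      shift = solve-∀

    κ-same-side-bounces : ∀ D j u v → s u ≡ s v →
      κ (bounce D (replicate j (u , v))) ≡ κ D ℤ.+ + j ℤ.* (σ u ℤ.+ σ u)
    κ-same-side-bounces D j u v same =
      trans (κ-bounce D (replicate j (u , v))) (cong (λ x → κ D ℤ.+ x) (signed-ends-replicate j u v same))

    odd-balance : ∀ k .{{_ : NonZero k}} h → suc k ≡ h + h → ∀ D u v → s u ≡ s v →
      ∃[ j ] j < k × + k ∣ κ (bounce D (replicate j (u , v)))
    odd-balance k h 1+k≡2h D u v same with odd-modulus-correction k h 1+k≡2h (κ D) (σ u) (sign² (s u))
    ... | j , j<k , k∣ = j , j<k , subst (+ k ∣_) (sym (κ-same-side-bounces D j u v same)) k∣

    even-balance : ∀ h .{{_ : NonZero h}} D → Even (κ D) → ∀ u v → s u ≡ s v →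
      ∃[ j ] j < h × + (h + h) ∣ κ (bounce D (replicate j (u , v)))
    even-balance h D even u v same with even-modulus-correction h (κ D) (σ u) even (sign² (s u))
    ... | j , j<h , 2h∣ = j , j<h , subst (+ (h + h) ∣_) (sym (κ-same-side-bounces D j u v same)) 2h∣

module _ (G : Graph) where

  private
    V : Set
    V = Fin (n G)

  Adj-sym : ∀ {u v} → Adj G u v → Adj G v u
  Adj-sym {u} {v} u~v = trans (Graph.sym G v u) u~v

  Adj⇒≢ : ∀ {u v} → Adj G u v → u ≢ v
  Adj⇒≢ {u} u~u refl with trans (sym u~u) (loopless G u)
  ... | ()

  IsWalk-++ : ∀ xs y ys → IsWalk G (xs ++ [ y ]) → IsWalk G (y ∷ ys) → IsWalk G (xs ++ y ∷ ys)
  IsWalk-++ []             y ys _            w₂ = w₂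
  IsWalk-++ (x ∷ [])       y ys (x~y , _)    w₂ = x~y , w₂
  IsWalk-++ (x₁ ∷ x₂ ∷ xs) y ys (x₁~x₂ , w₁) w₂ = x₁~x₂ , IsWalk-++ (x₂ ∷ xs) y ys w₁ w₂

  IsWalk-++⁻ : ∀ xs y ys → IsWalk G (xs ++ y ∷ ys) → IsWalk G (xs ++ [ y ]) × IsWalk G (y ∷ ys)
  IsWalk-++⁻ []             y ys w                 = tt , w
  IsWalk-++⁻ (x ∷ [])       y ys (x~y , w)         = (x~y , tt) , w
  IsWalk-++⁻ (x₁ ∷ x₂ ∷ xs) y ys (x₁~x₂ , w) with IsWalk-++⁻ (x₂ ∷ xs) y ys w
  ... | w₁ , w₂ = (x₁~x₂ , w₁) , w₂

  Traverses⇒Adj : ∀ w {u v} → IsWalk G w → Traverses w u v → Adj G u v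
  Traverses⇒Adj (x ∷ y ∷ w) (x~y , _) (inj₁ (inj₁ (refl , refl))) = x~y
  Traverses⇒Adj (x ∷ y ∷ w) (x~y , _) (inj₁ (inj₂ (refl , refl))) = Adj-sym x~y
  Traverses⇒Adj (x ∷ y ∷ w) (_ , walk) (inj₂ later)               = Traverses⇒Adj (y ∷ w) walk later

  -- The walk  w ++ [ r ]  visits every vertex and ends at r; it is closed when w starts at r.
  record Tour (r : V) (w : List V) : Set where
    field
      walk   : IsWalk G (w ++ [ r ])
      covers : ∀ v → v ∈ w
  open Tour

  Tour-bounce : ∀ {r w} x y → Adj G x y → Tour r w →
    ∃[ w′ ] Tour r w′ × length w′ ≡ 2 + length w
            × (∀ v → extra v (w′ ++ [ r ]) ≡ extra v (w ++ [ r ]) + 2 * (ind x v + ind y v))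
  Tour-bounce {r} x y x~y tour with ∈-∃++ (covers tour x)
  ... | A , B , refl = A ++ x ∷ y ∷ x ∷ B , record { walk = walk′ ; covers = covers′ } , length′ , extra′
    where
    closed≡ : ∀ C → (A ++ x ∷ C) ++ [ r ] ≡ A ++ x ∷ C ++ [ r ]
    closed≡ C = ListP.++-assoc A (x ∷ C) [ r ]
    split : IsWalk G (A ++ [ x ]) × IsWalk G (x ∷ B ++ [ r ])
    split = IsWalk-++⁻ A x (B ++ [ r ]) (subst (IsWalk G) (closed≡ B) (walk tour))
    walk′ : IsWalk G ((A ++ x ∷ y ∷ x ∷ B) ++ [ r ])
    walk′ = subst (IsWalk G) (sym (closed≡ (y ∷ x ∷ B)))
                  (IsWalk-++ A x _ (proj₁ split) (x~y , Adj-sym x~y , proj₂ split))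
    covers′ : ∀ v → v ∈ A ++ x ∷ y ∷ x ∷ B
    covers′ v with ∈-++⁻ A (covers tour v)
    ... | inj₁ v∈A         = ∈-++⁺ˡ v∈A
    ... | inj₂ (here v≡x)  = ∈-++⁺ʳ A (here v≡x)
    ... | inj₂ (there v∈B) = ∈-++⁺ʳ A (there (there (there v∈B)))
    length′ : length (A ++ x ∷ y ∷ x ∷ B) ≡ 2 + length (A ++ x ∷ B)
    length′ rewrite ListP.length-++ A {x ∷ y ∷ x ∷ B} | ListP.length-++ A {x ∷ B} =
      trans (ℕP.+-suc (length A) _) (cong suc (ℕP.+-suc (length A) _))
    extra′ : ∀ v → extra v ((A ++ x ∷ y ∷ x ∷ B) ++ [ r ])
                   ≡ extra v ((A ++ x ∷ B) ++ [ r ]) + 2 * (ind x v + ind y v)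
    extra′ v rewrite closed≡ (y ∷ x ∷ B) | closed≡ B
               | extra-++ v A x (y ∷ x ∷ B ++ [ r ]) | extra-++ v A x (B ++ [ r ]) =
      regroup (extra v (A ++ [ x ])) (ind x v) (ind y v) (extra v (x ∷ B ++ [ r ]))
      where
      regroup : ∀ a i j c → a + (i + j + (j + i + c)) ≡ a + c + 2 * (i + j)
      regroup = ℕRing.solve-∀

  Tour-bounces : ∀ {r w} L → All (uncurry (Adj G)) L → Tour r w →
    ∃[ w′ ] Tour r w′ × length w′ ≡ 2 * length L + length w
            × (∀ v → extra v (w′ ++ [ r ]) ≡ bounce (λ u → extra u (w ++ [ r ])) L v)
  Tour-bounces []            []          tour = _ , tour , refl , λ v → sym (ℕP.+-identityʳ _)
  Tour-bounces {r} {w} ((x , y) ∷ L) (x~y ∷ adj) tour with Tour-bounces L adj tour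
  ... | w₁ , tour₁ , length₁ , extra₁ with Tour-bounce x y x~y tour₁
  ... | w₂ , tour₂ , length₂ , extra₂ =
    w₂ , tour₂ , trans length₂ (trans (cong (λ l → 2 + l) length₁) (count (length L) _)) ,
    λ v → trans (extra₂ v) (trans (cong (_+ 2 * (ind x v + ind y v)) (extra₁ v))
                                  (regroup (extra v (w ++ [ r ])) (ends L v) (ind x v + ind y v)))
    where
    count : ∀ l w → 2 + (2 * l + w) ≡ 2 * suc l + w
    count = ℕRing.solve-∀
    regroup : ∀ e b i → e + 2 * b + 2 * i ≡ e + 2 * (i + b)
    regroup = ℕRing.solve-∀

  closed-walk-as-tour : ∀ x y M → IsClosedWalk G (x ∷ y ∷ M) → (∀ v → v ∈ x ∷ y ∷ M) →
    ∃[ c ] Tour x (x ∷ c) × (x ∷ c) ++ [ x ] ≡ x ∷ y ∷ M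
  closed-walk-as-tour x y M (walk , last≡x) covers with lastOr-∷ʳ y M last≡x
  ... | c , y∷M≡ = c , record { walk = subst (IsWalk G) closed≡ walk ; covers = covers′ } , sym closed≡
    where
    closed≡ : x ∷ y ∷ M ≡ (x ∷ c) ++ [ x ]
    closed≡ = cong (x ∷_) y∷M≡
    covers′ : ∀ v → v ∈ x ∷ c
    covers′ v with ∈-++⁻ (x ∷ c) (subst (v ∈_) closed≡ (covers v))
    ... | inj₁ v∈x∷c        = v∈x∷c
    ... | inj₂ (here v≡x)   = here v≡x

  Tour-reroot : ∀ {x c} → Tour x (x ∷ c) → ∀ r →
    ∃[ w ] Tour r (r ∷ w) × length w ≡ length c
           × (∀ v → extra v ((r ∷ w) ++ [ r ]) ≡ extra v ((x ∷ c) ++ [ x ]))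
  Tour-reroot {x} {c} tour r with covers tour r
  ... | here refl = c , tour , refl , λ v → refl
  ... | there r∈c with ∈-∃++ r∈c
  ...   | A , B , refl = B ++ x ∷ A , record { walk = walk′ ; covers = covers′ } , length′ , extra′
    where
    closed≡ : ∀ {a} C D → (a ∷ C ++ D) ++ [ a ] ≡ a ∷ C ++ D ++ [ a ]
    closed≡ {a} C D = cong (a ∷_) (ListP.++-assoc C D [ a ])
    split : IsWalk G (x ∷ A ++ [ r ]) × IsWalk G (r ∷ B ++ [ x ])
    split = IsWalk-++⁻ (x ∷ A) r (B ++ [ x ]) (subst (IsWalk G) (closed≡ A (r ∷ B)) (walk tour))
    walk′ : IsWalk G ((r ∷ B ++ x ∷ A) ++ [ r ])
    walk′ = subst (IsWalk G) (sym (closed≡ B (x ∷ A)))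
                  (IsWalk-++ (r ∷ B) x (A ++ [ r ]) (proj₂ split) (proj₁ split))
    covers′ : ∀ v → v ∈ r ∷ B ++ x ∷ A
    covers′ v = ∈-resp-↭ (++-comm (x ∷ A) (r ∷ B)) (covers tour v)
    length′ : length (B ++ x ∷ A) ≡ length (A ++ r ∷ B)
    length′ = trans (ListP.length-++-comm B (x ∷ A))
                    (trans (cong suc (ListP.length-++-comm A B)) (ListP.length-++-comm (r ∷ B) A))
    extra′ : ∀ v → extra v ((r ∷ B ++ x ∷ A) ++ [ r ]) ≡ extra v ((x ∷ A ++ r ∷ B) ++ [ x ])
    extra′ v = begin
      extra v ((r ∷ B ++ x ∷ A) ++ [ r ])                  ≡⟨ cong (extra v) (closed≡ B (x ∷ A)) ⟩
      extra v (r ∷ B ++ x ∷ A ++ [ r ])                    ≡⟨ extra-++ v (r ∷ B) x (A ++ [ r ]) ⟩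
      extra v (r ∷ B ++ [ x ]) + extra v (x ∷ A ++ [ r ])  ≡⟨ ℕP.+-comm (extra v (r ∷ B ++ [ x ])) _ ⟩
      extra v (x ∷ A ++ [ r ]) + extra v (r ∷ B ++ [ x ])  ≡⟨ extra-++ v (x ∷ A) r (B ++ [ x ]) ⟨
      extra v (x ∷ A ++ r ∷ B ++ [ x ])                    ≡⟨ cong (extra v) (closed≡ A (r ∷ B)) ⟨
      extra v ((x ∷ A ++ r ∷ B) ++ [ x ])                  ∎
      where open ≡-Reasoning

  Tour-with-tail : ∀ {r w} → Tour r w → ∀ t → IsWalk G (r ∷ t) → ∀ L → All (uncurry (Adj G)) L →
    ∃[ F ] IsWalk G F × walkLength F ≡ 2 * length L + length w + length t
           × (∀ v → extra v F ≡ bounce (λ u → extra u (w ++ [ r ]) + extra u (r ∷ t)) L v)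
  Tour-with-tail {r} {w} tour t tail-walk L edges with Tour-bounces L edges tour
  ... | w′ , tour′ , length′ , extra′ =
    w′ ++ r ∷ t , IsWalk-++ w′ r t (walk tour′) tail-walk , length≡ , extra≡
    where
    length≡ : walkLength (w′ ++ r ∷ t) ≡ 2 * length L + length w + length t
    length≡ = begin
      length (w′ ++ r ∷ t) ∸ 1        ≡⟨ cong (_∸ 1) (ListP.length-++ w′) ⟩
      (length w′ + suc (length t)) ∸ 1 ≡⟨ cong (_∸ 1) (ℕP.+-suc (length w′) (length t)) ⟩
      length w′ + length t             ≡⟨ cong (_+ length t) length′ ⟩
      2 * length L + length w + length t ∎
      where open ≡-Reasoning
    extra≡ : ∀ v → extra v (w′ ++ r ∷ t) ≡ bounce (λ u → extra u (w ++ [ r ]) + extra u (r ∷ t)) L v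
    extra≡ v = begin
      extra v (w′ ++ r ∷ t)                                       ≡⟨ extra-++ v w′ r t ⟩
      extra v (w′ ++ [ r ]) + extra v (r ∷ t)                     ≡⟨ cong (_+ extra v (r ∷ t)) (extra′ v) ⟩
      extra v (w ++ [ r ]) + 2 * ends L v + extra v (r ∷ t)       ≡⟨ swap (extra v (w ++ [ r ])) _ _ ⟩
      extra v (w ++ [ r ]) + extra v (r ∷ t) + 2 * ends L v       ∎
      where
      open ≡-Reasoning
      swap : ∀ a b c → a + b + c ≡ a + c + b
      swap = ℕRing.solve-∀

module _ (G : Graph) (r : Fin (n G)) where

  private
    V : Set
    V = Fin (n G)

  children : List (V × V) → List V
  children = map proj₁

  -- Entries are (child , parent), most recently attached first: the head child is a leaf.
  data Tree : List (V × V) → Set where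
    trivial : Tree []
    attach  : ∀ {x p T} → x ∉ r ∷ children T → p ∈ r ∷ children T → Adj G x p → Tree T →
              Tree ((x , p) ∷ T)

  private
    lift : ∀ {v x} {vs : List V} → v ∈ r ∷ vs → v ∈ r ∷ x ∷ vs
    lift (here v≡r)  = here v≡r
    lift (there v∈)  = there (there v∈)

  grow : ∀ {T} → Tree T → ∀ prev ys → prev ∈ r ∷ children T → IsWalk G (prev ∷ ys) →
    ∃[ T′ ] Tree T′ × (∀ {v} → v ∈ r ∷ children T → v ∈ r ∷ children T′)
                    × (∀ {v} → v ∈ ys → v ∈ r ∷ children T′)
  grow t prev []       _     _               = _ , t , (λ v∈ → v∈) , λ ()
  grow {T} t prev (y ∷ ys) prev∈ (prev~y , walk) with ∈? _≟_ y (r ∷ children T)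
  ... | yes y∈ with grow t y ys y∈ walk
  ...   | T′ , t′ , keep , reach = T′ , t′ , keep , λ { (here refl) → keep y∈ ; (there v∈) → reach v∈ }
  grow {T} t prev (y ∷ ys) prev∈ (prev~y , walk) | no y∉
    with grow (attach y∉ prev∈ (Adj-sym G prev~y) t) y ys (there (here refl)) walk
  ... | T′ , t′ , keep , reach =
    T′ , t′ , keep ∘ lift , λ { (here refl) → keep (there (here refl)) ; (there v∈) → reach v∈ }

  spanning-tree : ∀ ys → IsWalk G (r ∷ ys) → ∃[ T ] Tree T × (∀ {v} → v ∈ r ∷ ys → v ∈ r ∷ children T)
  spanning-tree ys walk with grow trivial r ys (here refl) walk
  ... | T , t , keep , reach = T , t , λ { (here refl) → keep (here refl) ; (there v∈) → reach v∈ }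

  Tree-unique : ∀ {T} → Tree T → Unique (r ∷ children T)
  Tree-unique trivial = [] ∷ []
  Tree-unique (attach x∉ _ _ t) with Tree-unique t
  ... | r≢ ∷ u = ((λ r≡x → x∉ (here (sym r≡x))) ∷ r≢) ∷ ¬Any⇒All¬ _ (x∉ ∘ there) ∷ u

  Tree-length : ∀ {T} → Tree T → length T ≤ n G ∸ 1
  Tree-length {T} t = ℕP.≤-trans (ℕP.≤-reflexive (sym (ListP.length-map proj₁ T)))
                                  (ℕP.∸-monoˡ-≤ 1 (Unique-length≤ (Tree-unique t)))

  Tree-entry : ∀ {T x p} → Tree T → (x , p) ∈ T → x ∈ children T × p ∈ r ∷ children T
  Tree-entry (attach _ p∈ _ _) (here refl) = here refl , lift p∈
  Tree-entry (attach _ _ _ t)  (there e∈) with Tree-entry t e∈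
  ... | x∈ , p∈ = there x∈ , lift p∈

  Tree-adj : ∀ {T x p} → Tree T → (x , p) ∈ T → Adj G x p
  Tree-adj (attach _ _ x~p _) (here refl) = x~p
  Tree-adj (attach _ _ _ t)   (there e∈)  = Tree-adj t e∈

  side : List (V × V) → V → Bool
  side []            v = true
  side ((x , p) ∷ T) v = if does (v ≟ x) then not (side T p) else side T v

  private
    side-new : ∀ x p T → side ((x , p) ∷ T) x ≡ not (side T p)
    side-new x p T with x ≟ x
    ... | yes _   = refl
    ... | no  x≢x = contradiction refl x≢x

    side-old : ∀ x p T {v} → v ∈ r ∷ children T → x ∉ r ∷ children T → side ((x , p) ∷ T) v ≡ side T v
    side-old x p T {v} v∈ x∉ with v ≟ x
    ... | yes refl = contradiction v∈ x∉
    ... | no  _    = refl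

  side-edge : ∀ {T x p} → Tree T → (x , p) ∈ T → side T x ≡ not (side T p)
  side-edge {(x , p) ∷ T} (attach x∉ p∈ _ _) (here refl) =
    trans (side-new x p T) (cong not (sym (side-old x p T p∈ x∉)))
  side-edge {(x′ , p′) ∷ T} (attach x′∉ _ _ t) (there e∈) with Tree-entry t e∈
  ... | x∈ , p∈ = trans (side-old x′ p′ T (there x∈) x′∉)
                        (trans (side-edge t e∈) (cong not (sym (side-old x′ p′ T p∈ x′∉))))

  tree-corrections : ∀ k .{{_ : NonZero k}} (col : V → ℕ) {T} → Tree T → ∀ D →
    ∃[ L ] All (_∈ T) L × length L ≤ (k ∸ 1) * length T
           × (∀ {x} → x ∈ children T → + k ∣ excess col (bounce D L) x)
  tree-corrections k col trivial D = [] , [] , z≤n , λ ()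
  tree-corrections k col {(x , p) ∷ T} (attach x∉ p∈ _ t) D with shift-to-multiple k (excess col D x)
  ... | j , j<k , k∣x with tree-corrections k col t (bounce D (replicate j (x , p)))
  ... | L , L⊆T , length≤ , on-target =
    Lx ++ L , AllP.++⁺ (AllP.replicate⁺ j (here refl)) (All.map there L⊆T) , length′ , on-target′
    where
    Lx : List (V × V)
    Lx = replicate j (x , p)
    length′ : length (Lx ++ L) ≤ (k ∸ 1) * suc (length T)
    length′ = begin
      length (Lx ++ L)                 ≡⟨ ListP.length-++ Lx ⟩
      length Lx + length L             ≡⟨ cong (_+ length L) (ListP.length-replicate j) ⟩
      j + length L                     ≤⟨ ℕP.+-mono-≤ (ℕP.∸-monoˡ-≤ 1 j<k) length≤ ⟩
      (k ∸ 1) + (k ∸ 1) * length T     ≡⟨ ℕP.*-suc (k ∸ 1) (length T) ⟨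
      (k ∸ 1) * suc (length T)         ∎
      where open ℕP.≤-Reasoning
    x-untouched : ends L x ≡ 0
    x-untouched = ends-avoiding x (All.map avoids L⊆T)
      where
      avoids : ∀ {e} → e ∈ T → proj₁ e ≢ x × proj₂ e ≢ x
      avoids e∈ with Tree-entry t e∈
      ... | c∈ , q∈ = (λ { refl → x∉ (there c∈) }) , (λ { refl → x∉ q∈ })
    x-ends : ends (Lx ++ L) x ≡ j
    x-ends = begin
      ends (Lx ++ L) x                     ≡⟨ ends-++ Lx L x ⟩
      ends Lx x + ends L x                 ≡⟨ cong₂ _+_ (ends-replicate j x p x) x-untouched ⟩
      j * (ind x x + ind p x) + 0
        ≡⟨ cong₂ (λ a b → j * (a + b) + 0) (ind-refl x) (ind-≢ {x = p} {x} (λ { refl → x∉ p∈ })) ⟩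
      j * 1 + 0                            ≡⟨ trans (ℕP.+-identityʳ _) (ℕP.*-identityʳ j) ⟩
      j                                    ∎
      where open ≡-Reasoning
    on-target′ : ∀ {v} → v ∈ x ∷ children T → + k ∣ excess col (bounce D (Lx ++ L)) v
    on-target′ (here refl) = subst (λ e → + k ∣ e)
      (sym (trans (excess-bounce col D (Lx ++ L) x) (cong (λ e → excess col D x ℤ.+ + e) x-ends))) k∣x
    on-target′ {v} (there v∈) =
      subst (λ d → + k ∣ + (d / 2) ℤ.- + col v) (sym (bounce-++ D Lx L v)) (on-target v∈)

  all-on-target : ∀ k .{{_ : NonZero k}} (col : V → ℕ) {T} → Tree T →
    (∀ v → v ∈ r ∷ children T) → ∀ D →
    + k ∣ Signed.κ (side T) col D →
    ∃[ L ] All (_∈ T) L × length L ≤ (k ∸ 1) * (n G ∸ 1) × (∀ v → + k ∣ excess col (bounce D L) v)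
  all-on-target k col {T} t spans D k∣κ with tree-corrections k col t D
  ... | L , L⊆T , length≤ , on-target =
    L , L⊆T , ℕP.≤-trans length≤ (ℕP.*-monoʳ-≤ (k ∸ 1) (Tree-length t)) , everywhere
    where
    open Signed (side T)
    κ-unchanged : κ col (bounce D L) ≡ κ col D
    κ-unchanged = trans (κ-bounce col D L)
      (trans (cong (λ x → κ col D ℤ.+ x) (signed-ends-balanced (All.map (side-edge t) L⊆T))) (ℤP.+-identityʳ _))
    everywhere : ∀ v → + k ∣ excess col (bounce D L) v
    everywhere v with spans v
    ... | there v∈ = on-target v∈
    ... | here refl = root-on-target col (bounce D L) r (subst (+ k ∣_) (sym κ-unchanged) k∣κ) others
      where
      others : ∀ u → u ≢ r → + k ∣ excess col (bounce D L) u
      others u u≢r with spans u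
      ... | here u≡r = contradiction u≡r u≢r
      ... | there u∈ = on-target u∈

module _ (G : Graph) where

  private
    V : Set
    V = Fin (n G)

  neighbours-injection : ∀ {a} x (f : Fin a → V) → Injective _≡_ _≡_ f → (∀ i → Adj G x (f i)) →
    a ≤ deg G x
  neighbours-injection x f inj adjacent =
    subst (_ ≤_) (sym deg≡) (injection-count neighbour f inj one)
    where
    neighbour : V → ℕ
    neighbour u = if adj G x u then 1 else 0
    deg≡ : deg G x ≡ ℕΣ.sum neighbour
    deg≡ = trans (cong ListAction.sum (ListP.map-tabulate {n = n G} id neighbour))
                 (sum-tabulate neighbour)
    one : ∀ i → 1 ≤ neighbour (f i)
    one i rewrite adjacent i = ℕP.≤-refl

  private
    avoids? : ∀ {q} (col : V → Fin q) x t u → Dec (Adj G x u → col u ≢ t)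
    avoids? col x t u = (adj G x u Bool.≟ true) →-dec ¬? (col u ≟ t)

  free-colour : ∀ Δ (col : V → Fin (suc Δ)) x → deg G x ≤ Δ → ∃[ t ] (∀ u → Adj G x u → col u ≢ t)
  free-colour Δ col x deg≤Δ with FinP.any? (λ t → FinP.all? (avoids? col x t))
  ... | yes free = free
  ... | no  none = contradiction (neighbours-injection x witness witness-inj witness-adj) (ℕP.<⇒≱ (s≤s deg≤Δ))
    where
    used : ∀ t → ∃[ u ] Adj G x u × col u ≡ t
    used t with FinP.¬∀⟶∃¬ _ _ (avoids? col x t) (λ free → none (t , free))
    ... | u , not-free with adj G x u Bool.≟ true | col u ≟ t
    ...   | yes x~u | yes colour≡ = u , x~u , colour≡
    ...   | no ¬x~u | _           = contradiction (λ x~u → contradiction x~u ¬x~u) not-free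
    ...   | yes _   | no colour≢  = contradiction (λ _ → colour≢) not-free
    witness : Fin (suc Δ) → V
    witness t = proj₁ (used t)
    witness-adj : ∀ t → Adj G x (witness t)
    witness-adj t = proj₁ (proj₂ (used t))
    witness-inj : Injective _≡_ _≡_ witness
    witness-inj {t} {t′} eq =
      trans (sym (proj₂ (proj₂ (used t)))) (trans (cong col eq) (proj₂ (proj₂ (used t′))))

  ProperBelow : ∀ {q} → (V → Fin q) → ℕ → Set
  ProperBelow col m = ∀ u v → toℕ u < m → toℕ v < m → Adj G u v → col u ≢ col v

  recolour : ∀ {q} (col : V → Fin q) x t → (∀ u → Adj G x u → col u ≢ t) → ProperBelow col (toℕ x) →
    ProperBelow (updateAt col x (const t)) (suc (toℕ x))
  recolour col x t free proper u v u≤x v≤x u~v eq with u ≟ x | v ≟ x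
  ... | yes refl | yes refl = Adj⇒≢ G u~v refl
  ... | yes refl | no  v≢x  =
    free v u~v (sym (trans (sym (updateAt-updates x col)) (trans eq (updateAt-minimal v x col v≢x))))
  ... | no  u≢x  | yes refl =
    free u (Adj-sym G u~v) (trans (sym (updateAt-minimal u x col u≢x)) (trans eq (updateAt-updates x col)))
  ... | no  u≢x  | no  v≢x  = proper u v (below u≤x u≢x) (below v≤x v≢x) u~v
    (trans (sym (updateAt-minimal u x col u≢x)) (trans eq (updateAt-minimal v x col v≢x)))
    where
    below : ∀ {w} → toℕ w < suc (toℕ x) → w ≢ x → toℕ w < toℕ x
    below w≤x w≢x = ℕP.≤∧≢⇒< (ℕP.≤-pred w≤x) (w≢x ∘ FinP.toℕ-injective)

  greedy-colouring : ∀ Δ → (∀ v → deg G v ≤ Δ) → ∀ m → m ≤ n G → ∃[ col ] ProperBelow {suc Δ} col m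
  greedy-colouring Δ deg≤ zero    _   = (λ _ → zero) , λ _ _ ()
  greedy-colouring Δ deg≤ (suc m) m<n with greedy-colouring Δ deg≤ m (ℕP.<⇒≤ m<n)
  ... | col , proper with free-colour Δ col (fromℕ< m<n) (deg≤ (fromℕ< m<n))
  ...   | t , free =
    updateAt col x (const t) ,
    subst (ProperBelow (updateAt col x (const t)) ∘ suc) (FinP.toℕ-fromℕ< m<n)
          (recolour col x t free (subst (ProperBelow col) (sym (FinP.toℕ-fromℕ< m<n)) proper))
    where
    x : V
    x = fromℕ< m<n

  χ≤Δ+1 : ∀ {Δ k} → MaxDegree G Δ → ChromaticNumber G k → k ≤ suc Δ
  χ≤Δ+1 {Δ} {k} (deg≤ , _) (_ , minimal) with k ℕP.≤? suc Δ
  ... | yes k≤ = k≤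
  ... | no  k≰ with greedy-colouring Δ deg≤ (n G) ℕP.≤-refl
  ...   | col , proper =
    contradiction (col , λ u v → proper u v (FinP.toℕ<n u) (FinP.toℕ<n v)) (minimal (suc Δ) (ℕP.≰⇒> k≰))

  irregular-from-targets : ∀ {k F} (c : V → Fin k) → ProperColouring G k c → IsWalk G F →
    (∀ v → + k ∣ excess (toℕ ∘ c) (degPlus G F) v) → LocallyIrregularPlus G F
  irregular-from-targets {k} {F} c proper walk on-target u v u~v same-degree =
    proper u v (edge u~v) (FinP.toℕ-injective (residue-unique (FinP.toℕ<n (c u)) (FinP.toℕ<n (c v)) k∣cu-cv))
    where
    edge : AdjPlus G F u v → Adj G u v
    edge (inj₁ in-G)     = in-G
    edge (inj₂ traverse) = Traverses⇒Adj G F walk traverse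
    k∣cu-cv : + k ∣ + toℕ (c u) ℤ.- + toℕ (c v)
    k∣cu-cv = subst (+ k ∣_) (difference (+ (degPlus G F v / 2)) (+ toℕ (c u)) (+ toℕ (c v)))
      (∣m∣n⇒∣m-n (on-target v) (subst (λ d → + k ∣ + (d / 2) ℤ.- + toℕ (c u)) same-degree (on-target u)))
      where
      difference : ∀ h a b → h ℤ.- b ℤ.- (h ℤ.- a) ≡ a ℤ.- b
      difference = solve-∀

  record Balancing (k Δ : ℕ) (s : V → Bool) (col : V → ℕ) (r : V) (D : V → ℕ) : Set where
    field
      tail         : List V
      bounces      : List (V × V)
      tail-walk    : IsWalk G (r ∷ tail)
      bounce-edges : All (uncurry (Adj G)) bounces
      cost         : length tail + 2 * length bounces ≤ 2 * Δ
      balanced     : + k ∣ Signed.κ s col (bounce (λ v → D v + extra v (r ∷ tail)) bounces)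

  assemble : ∀ {k Δ} .{{_ : NonZero k}} (c : V → Fin k) → ProperColouring G k c →
    ∀ {r w T} → Tour G r w → Tree G r T → (∀ v → v ∈ r ∷ children G r T) →
    Balancing k Δ (side G r T) (toℕ ∘ c) r (λ v → deg G v + extra v (w ++ [ r ])) →
    MLW≤ G (length w + (n G ∸ 1) * (2 * k ∸ 2) + 2 * Δ)
  assemble {k} {Δ} c proper {r} {w} {T} tour t spans b
    with all-on-target G r k (toℕ ∘ c) t spans
           (bounce (λ v → deg G v + extra v (w ++ [ r ]) + extra v (r ∷ Balancing.tail b)) (Balancing.bounces b))
           (Balancing.balanced b)
  ... | L , L⊆T , length-L , on-target
    with Tour-with-tail G tour (Balancing.tail b) (Balancing.tail-walk b) (Balancing.bounces b ++ L)
           (AllP.++⁺ (Balancing.bounce-edges b) (All.map (Tree-adj G r t) L⊆T))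
  ... | F , walk , length-F , extra-F = F , (walk , irregular-from-targets c proper walk on-target′) , length-bound
    where
    open Balancing b
    D₁ : V → ℕ
    D₁ v = deg G v + extra v (w ++ [ r ]) + extra v (r ∷ tail)
    degree≡ : ∀ v → degPlus G F v ≡ bounce (bounce D₁ bounces) L v
    degree≡ v = trans (cong (λ e → deg G v + e) (extra-F v))
                      (trans (regroup (deg G v) (extra v (w ++ [ r ])) (extra v (r ∷ tail)) (ends (bounces ++ L) v))
                             (bounce-++ D₁ bounces L v))
      where
      regroup : ∀ d e t l → d + (e + t + 2 * l) ≡ d + e + t + 2 * l
      regroup = ℕRing.solve-∀
    on-target′ : ∀ v → + k ∣ excess (toℕ ∘ c) (degPlus G F) v
    on-target′ v = subst (λ d → + k ∣ + (d / 2) ℤ.- + toℕ (c v)) (sym (degree≡ v)) (on-target v)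
    length-bound : walkLength F ≤ length w + (n G ∸ 1) * (2 * k ∸ 2) + 2 * Δ
    length-bound = begin
      walkLength F
        ≡⟨ length-F ⟩
      2 * length (bounces ++ L) + length w + length tail
        ≡⟨ cong (λ l → 2 * l + length w + length tail) (ListP.length-++ bounces) ⟩
      2 * (length bounces + length L) + length w + length tail
        ≡⟨ regroup (length bounces) (length L) (length w) (length tail) ⟩
      length w + 2 * length L + (length tail + 2 * length bounces)
        ≤⟨ ℕP.+-mono-≤ (ℕP.+-monoʳ-≤ (length w) tree-cost) cost ⟩
      length w + (n G ∸ 1) * (2 * k ∸ 2) + 2 * Δ ∎
      where
      open ℕP.≤-Reasoning
      regroup : ∀ g l w t → 2 * (g + l) + w + t ≡ w + 2 * l + (t + 2 * g)
      regroup = ℕRing.solve-∀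
      tree-cost : 2 * length L ≤ (n G ∸ 1) * (2 * k ∸ 2)
      tree-cost = ℕP.≤-trans (ℕP.*-monoʳ-≤ 2 length-L) (ℕP.≤-reflexive (double-product k (n G ∸ 1)))

  Path₂ : Set
  Path₂ = ∃[ a ] ∃[ b ] ∃[ c ] Adj G a b × Adj G b c × a ≢ c

  walk-path₂ : ∀ x y ws → IsWalk G (x ∷ y ∷ ws) → ∀ {z} → z ∈ ws → z ≢ x → z ≢ y → Path₂
  walk-path₂ x y (w ∷ ws) (x~y , y~w , walk) {z} z∈ z≢x z≢y with x ≟ w
  ... | no  x≢w  = x , y , w , x~y , y~w , x≢w
  ... | yes refl with z∈
  ...   | here z≡x  = contradiction z≡x z≢x
  ...   | there z∈ws = walk-path₂ y x ws (y~w , walk) z∈ws z≢y z≢x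

  record OddTail (D : V → ℕ) : Set where
    field
      root  : V
      tail  : List V
      walk  : IsWalk G (root ∷ tail)
      short : length tail ≤ 2
      odd   : ∀ s → Odd (Signed.Φ s (λ v → D v + extra v (root ∷ tail)) ℤ.- Signed.Φ s D)

  private
    shifted : ∀ {a b δ} → a ≡ b ℤ.+ δ → Odd δ → Odd (a ℤ.- b)
    shifted {a} {b} {δ} refl = subst Odd (sym (cancel b δ))
      where
      cancel : ∀ b δ → b ℤ.+ δ ℤ.- b ≡ δ
      cancel = solve-∀

  odd-tail : Path₂ → ∀ D → OddTail D
  odd-tail (a , b , c , a~b , b~c , a≢c) D with D a % 2 ℕP.≟ D c % 2 | D a % 2 ℕP.≟ D b % 2
  ... | yes a≡c | _ = record
    { root = a ; tail = b ∷ c ∷ [] ; walk = a~b , b~c , _ ; short = ℕP.≤-refl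
    ; odd = λ s → shifted (Signed.Φ-path-tail s D a b c (Adj⇒≢ G a~b) (Adj⇒≢ G b~c) a≢c)
                          (odd-path-change (s a) (s b) (s c) (D a) (D c) a≡c) }
  ... | no  _   | no a≢b = record
    { root = a ; tail = b ∷ [] ; walk = a~b , _ ; short = s≤s z≤n
    ; odd = λ s → shifted (Signed.Φ-edge-tail s D a b (Adj⇒≢ G a~b))
                          (odd-edge-change (s a) (s b) (D a) (D b) a≢b) }
  ... | no  a≢c | yes a≡b = record
    { root = b ; tail = c ∷ [] ; walk = b~c , _ ; short = s≤s z≤n
    ; odd = λ s → shifted (Signed.Φ-edge-tail s D b c (Adj⇒≢ G b~c))
                          (odd-edge-change (s b) (s c) (D b) (D c) (a≢c ∘ trans a≡b)) }

  OddTail-cong : ∀ {D D′} → (∀ v → D v ≡ D′ v) → OddTail D → OddTail D′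
  OddTail-cong {D} {D′} D≗D′ ot = record
    { root = root ; tail = tail ; walk = walk ; short = short
    ; odd = λ s → subst₂ (λ x y → Odd (x ℤ.- y))
                         (Signed.Φ-cong s (λ v → cong (_+ extra v (root ∷ tail)) (D≗D′ v)))
                         (Signed.Φ-cong s D≗D′) (odd s) }
    where open OddTail ot

  even-tail : ∀ s col {D} (ot : OddTail D) → let open OddTail ot in
    ∃[ t ] IsWalk G (root ∷ t) × length t ≤ 2 × Even (Signed.κ s col (λ v → D v + extra v (root ∷ t)))
  even-tail s col {D} ot with Signed.parity-fix s col (λ v → D v + 0) (λ v → D v + extra v (root ∷ tail)) odd′
    where
    open OddTail ot
    odd′ : Odd (Signed.Φ s (λ v → D v + extra v (root ∷ tail)) ℤ.- Signed.Φ s (λ v → D v + 0))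
    odd′ = subst (λ x → Odd (Signed.Φ s (λ v → D v + extra v (root ∷ tail)) ℤ.- x))
                 (Signed.Φ-cong s (λ v → sym (ℕP.+-identityʳ (D v)))) (odd s)
  ... | inj₁ even = [] , _ , z≤n , even
  ... | inj₂ even = OddTail.tail ot , OddTail.walk ot , OddTail.short ot , even

  same-side-or-two-colourable : (s : V → Bool) → (∃[ u ] ∃[ v ] Adj G u v × s u ≡ s v) ⊎ Colourable G 2
  same-side-or-two-colourable s
    with FinP.any? (λ u → FinP.any? (λ v → (adj G u v Bool.≟ true) ×-dec (s u Bool.≟ s v)))
  ... | yes (u , v , u~v , same) = inj₁ (u , v , u~v , same)
  ... | no  none = inj₂ (colour ∘ s , λ u v u~v eq → none (u , v , u~v , colour-injective (s u) (s v) eq))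
    where
    colour : Bool → Fin 2
    colour true  = zero
    colour false = suc zero
    colour-injective : ∀ a b → colour a ≡ colour b → a ≡ b
    colour-injective true  true  _ = refl
    colour-injective false false _ = refl

  χ≥2 : ∀ {k u v} → ChromaticNumber G k → Adj G u v → 2 ≤ k
  χ≥2 {zero}     {u}     ((c , _) , _)      _   with c u
  ... | ()
  χ≥2 {suc zero} {u} {v} ((c , proper) , _) u~v with c u | c v | proper u v u~v
  ... | zero | zero | different = contradiction refl different
  χ≥2 {suc (suc k)} _ _ = s≤s (s≤s z≤n)

  χ≤2 : ∀ {k} → ChromaticNumber G k → Colourable G 2 → k ≤ 2
  χ≤2 {k} (_ , minimal) two-colourable with k ℕP.≤? 2
  ... | yes k≤2 = k≤2
  ... | no  k≰2 = contradiction two-colourable (minimal 2 (ℕP.≰⇒> k≰2))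

  private
    bounce-cost : ∀ (t : List V) j (u v : V) → length t + 2 * length (replicate j (u , v)) ≡ length t + 2 * j
    bounce-cost t j u v = cong (λ l → length t + 2 * l) (ListP.length-replicate j)

  balancing-two-colourable : ∀ {k Δ} s col {D} → 1 ≤ Δ → k ≡ 2 → (ot : OddTail D) →
    Balancing k Δ s col (OddTail.root ot) D
  balancing-two-colourable s col {D} 1≤Δ refl ot with even-tail s col ot
  ... | t , t-walk , short , even = record
    { tail = t ; bounces = [] ; tail-walk = t-walk ; bounce-edges = []
    ; cost = ℕP.≤-trans (ℕP.≤-reflexive (ℕP.+-identityʳ (length t))) (ℕP.≤-trans short (ℕP.*-monoʳ-≤ 2 1≤Δ))
    ; balanced = subst (+ 2 ∣_) (sym (Signed.κ-bounce-[] s col (λ v → D v + extra v (OddTail.root ot ∷ t)))) even }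

  balancing-odd : ∀ {k Δ} .{{_ : NonZero k}} s col {D} h → suc k ≡ h + h → k ≤ suc Δ →
    ∀ {u v} → Adj G u v → s u ≡ s v → (ot : OddTail D) → Balancing k Δ s col (OddTail.root ot) D
  balancing-odd {k} {Δ} s col {D} h 1+k≡2h k≤1+Δ {u} {v} u~v same ot
    with Signed.odd-balance s col k h 1+k≡2h (λ w → D w + extra w (OddTail.root ot ∷ [])) u v same
  ... | j , j<k , k∣ = record
    { tail = [] ; bounces = replicate j (u , v) ; tail-walk = _ ; bounce-edges = AllP.replicate⁺ j u~v
    ; cost = subst (_≤ 2 * Δ) (sym (bounce-cost [] j u v))
                   (ℕP.*-monoʳ-≤ 2 (ℕP.≤-pred (ℕP.≤-trans j<k k≤1+Δ)))
    ; balanced = k∣ }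

  balancing-even : ∀ {k Δ} s col {D} h .{{_ : NonZero h}} → k ≡ h + h → k ≤ suc Δ → 1 ≤ Δ →
    ∀ {u v} → Adj G u v → s u ≡ s v → (ot : OddTail D) → Balancing k Δ s col (OddTail.root ot) D
  balancing-even {k} {Δ} s col {D} h k≡2h k≤1+Δ 1≤Δ {u} {v} u~v same ot with even-tail s col ot
  ... | t , t-walk , short , even
    with Signed.even-balance s col h (λ w → D w + extra w (OddTail.root ot ∷ t)) even u v same
  ... | j , j<h , 2h∣ = record
    { tail = t ; bounces = replicate j (u , v) ; tail-walk = t-walk ; bounce-edges = AllP.replicate⁺ j u~v
    ; cost = cost ; balanced = subst (λ m → + m ∣ _) (sym k≡2h) 2h∣ }
    where
    cost : length t + 2 * length (replicate j (u , v)) ≤ 2 * Δ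
    cost = begin
      length t + 2 * length (replicate j (u , v)) ≡⟨ bounce-cost t j u v ⟩
      length t + 2 * j                           ≤⟨ ℕP.+-monoˡ-≤ (2 * j) short ⟩
      2 + 2 * j                                  ≡⟨ ℕP.*-suc 2 j ⟨
      2 * suc j                                  ≤⟨ ℕP.*-monoʳ-≤ 2 j<h ⟩
      2 * h                                      ≡⟨ cong (λ x → h + x) (ℕP.+-identityʳ h) ⟩
      h + h                                      ≡⟨ k≡2h ⟨
      k                                          ≤⟨ k≤1+Δ ⟩
      suc Δ                                      ≤⟨ ℕP.+-monoˡ-≤ Δ 1≤Δ ⟩
      Δ + Δ                                      ≡⟨ cong (λ x → Δ + x) (ℕP.+-identityʳ Δ) ⟨
      2 * Δ                                      ∎
      where open ℕP.≤-Reasoning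

  balancing : ∀ {k Δ} .{{_ : NonZero k}} → MaxDegree G Δ → ChromaticNumber G k → 2 ≤ k →
    (s : V → Bool) (col : V → ℕ) → ∀ {D} (ot : OddTail D) → Balancing k Δ s col (OddTail.root ot) D
  balancing {k} {Δ} md χ 2≤k s col ot = dispatch (same-side-or-two-colourable s) (halving k)
    where
    k≤1+Δ : k ≤ suc Δ
    k≤1+Δ = χ≤Δ+1 md χ
    1≤Δ : 1 ≤ Δ
    1≤Δ = ℕP.≤-pred (ℕP.≤-trans 2≤k k≤1+Δ)
    dispatch : (∃[ u ] ∃[ v ] Adj G u v × s u ≡ s v) ⊎ Colourable G 2 →
      (∃[ h ] k ≡ h + h) ⊎ (∃[ h ] suc k ≡ h + h) → Balancing k Δ s col (OddTail.root ot) _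
    dispatch (inj₂ two-colourable) _ =
      balancing-two-colourable s col 1≤Δ (ℕP.≤-antisym (χ≤2 χ two-colourable) 2≤k) ot
    dispatch (inj₁ (u , v , u~v , same)) (inj₂ (h , 1+k≡2h)) =
      balancing-odd s col h 1+k≡2h k≤1+Δ u~v same ot
    dispatch (inj₁ (u , v , u~v , same)) (inj₁ (zero , k≡0)) =
      contradiction (ℕP.≤-trans 2≤k (ℕP.≤-reflexive k≡0)) λ ()
    dispatch (inj₁ (u , v , u~v , same)) (inj₁ (suc h , k≡2h)) =
      balancing-even s col (suc h) k≡2h k≤1+Δ 1≤Δ u~v same ot

  covering-walk-path₂ : ∀ x y M → 3 ≤ n G → IsWalk G (x ∷ y ∷ M) → (∀ v → v ∈ x ∷ y ∷ M) → Path₂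
  covering-walk-path₂ x y M 3≤n walk covers with third-vertex 3≤n x y
  ... | z , z≢x , z≢y with covers z
  ...   | here z≡x          = contradiction z≡x z≢x
  ...   | there (here z≡y)  = contradiction z≡y z≢y
  ...   | there (there z∈M) = walk-path₂ x y M walk z∈M z≢x z≢y

  irregularising-walk : ∀ {Δ k} x y M → 3 ≤ n G → MaxDegree G Δ → ChromaticNumber G k →
    IsClosedWalk G (x ∷ y ∷ M) → CoversAllVertices G (x ∷ y ∷ M) →
    MLW≤ G (walkLength (x ∷ y ∷ M) + (n G ∸ 1) * (2 * k ∸ 2) + 2 * Δ)
  irregularising-walk {Δ} {k} x y M 3≤n md χ closed covers
    with closed-walk-as-tour G x y M closed covers
       | odd-tail (covering-walk-path₂ x y M 3≤n (proj₁ closed) covers) (λ v → deg G v + extra v (x ∷ y ∷ M))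
  ... | c , tour₀ , closed≡ | ot with Tour-reroot G tour₀ (OddTail.root ot)
  ... | w , tour , length≡ , extra≡ with spanning-tree G (OddTail.root ot) (w ++ [ OddTail.root ot ]) (Tour.walk tour)
  ... | T , t , spans = subst (λ l → MLW≤ G (l + (n G ∸ 1) * (2 * k ∸ 2) + 2 * Δ)) same-length
    (assemble colour proper tour t (spans ∘ ∈-++⁺ˡ ∘ Tour.covers tour)
      (balancing md χ 2≤k (side G r T) (toℕ ∘ colour) (OddTail-cong same-load ot)))
    where
    r : V
    r = OddTail.root ot
    colour : V → Fin k
    colour = proj₁ (proj₁ χ)
    proper : ProperColouring G k colour
    proper = proj₂ (proj₁ χ)
    2≤k : 2 ≤ k
    2≤k = χ≥2 χ (proj₁ (proj₁ closed))
    instance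
      k≢0 : NonZero k
      k≢0 = ℕ.>-nonZero (ℕP.≤-trans (s≤s z≤n) 2≤k)
    same-load : ∀ v → deg G v + extra v (x ∷ y ∷ M) ≡ deg G v + extra v ((r ∷ w) ++ [ r ])
    same-load v = cong (λ e → deg G v + e) (sym (trans (extra≡ v) (cong (extra v) closed≡)))
    same-length : length (r ∷ w) ≡ walkLength (x ∷ y ∷ M)
    same-length = begin
      suc (length w)      ≡⟨ cong suc length≡ ⟩
      suc (length c)      ≡⟨ ℕP.+-comm 1 (length c) ⟩
      length c + 1        ≡⟨ ListP.length-++ c ⟨
      length (c ++ [ x ]) ≡⟨ cong length (ListP.∷-injectiveʳ closed≡) ⟩
      length (y ∷ M)      ∎
      where open ≡-Reasoning

trivial-walk-irregularising : ∀ G → (∀ (u v : Fin (n G)) → u ≡ v) → ∀ x → Irregularising G (x ∷ [])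
trivial-walk-irregularising G all-equal x = _ , λ { u v (inj₁ u~v) _ → Adj⇒≢ G u~v (all-equal u v) }

connected-pair≅K2 : ∀ G → n G ≡ 2 → Connected G → Isomorphic G K2
connected-pair≅K2 record { adj = a ; sym = a-sym ; loopless = a-loopless } refl connected = ↔-id (Fin 2) , same-adjacency
  where
  0~1 : a zero (suc zero) ≡ true
  0~1 with connected zero (suc zero)
  ... | (_ ∷ []) , _ , refl , ()
  ... | (_ ∷ zero ∷ _) , (0~0 , _) , refl , _ with trans (sym 0~0) (a-loopless zero)
  ...   | ()
  0~1 | (_ ∷ suc zero ∷ _) , (0~1 , _) , refl , _ = 0~1
  same-adjacency : ∀ u v → a u v ≡ adj K2 u v
  same-adjacency zero       zero       = a-loopless zero
  same-adjacency zero       (suc zero) = 0~1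
  same-adjacency (suc zero) zero       = trans (a-sym (suc zero) zero) 0~1
  same-adjacency (suc zero) (suc zero) = a-loopless (suc zero)

theorem4p5 : (G : Graph) (Δ k p : ℕ) (W : List (Fin (n G))) →
    Nice G → MaxDegree G Δ → ChromaticNumber G k →
    IsClosedWalk G W → CoversAllVertices G W → walkLength W ≡ p →
    MLW≤ G (p + (n G ∸ 1) * (2 * k ∸ 2) + 2 * Δ)
theorem4p5 G Δ k p (x ∷ []) _ _ _ _ covers refl =
  x ∷ [] , trivial-walk-irregularising G (λ u v → trans (is-x (covers u)) (sym (is-x (covers v)))) x , z≤n
  where
  is-x : ∀ {u} → u ∈ x ∷ [] → u ≡ x
  is-x (here u≡x) = u≡x
  is-x (there ())
theorem4p5 G Δ k p (x ∷ y ∷ M) (connected , not-K2) md χ closed covers refl with n G ℕP.≤? 1 | n G ℕP.≟ 2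
... | yes n≤1 | _       =
  x ∷ [] , trivial-walk-irregularising G (λ u v → FinP.toℕ-injective (trans (toℕ≡0 u) (sym (toℕ≡0 v)))) x , z≤n
  where
  toℕ≡0 : ∀ (u : Fin (n G)) → toℕ u ≡ 0
  toℕ≡0 u = ℕP.n<1⇒n≡0 (ℕP.<-≤-trans (FinP.toℕ<n u) n≤1)
... | no  _   | yes n≡2 = contradiction (connected-pair≅K2 G n≡2 connected) not-K2
... | no  n≰1 | no  n≢2 =
  irregularising-walk G x y M (ℕP.≤∧≢⇒< (ℕP.≰⇒> n≰1) (n≢2 ∘ sym)) md χ closed covers
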